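{- The following sixteen mesh patterns $(12,R)$ are pairwise equidistributed, where $R$ ranges over: $\{(0,2),(1,2),(2,2),(2,1),(0,0)\}$, $\{(0,2),(2,2),(0,1),(0,0),(1,0)\}$, $\{(1,2),(2,2),(2,1),(0,0),(2,0)\}$, $\{(2,2),(0,1),(0,0),(1,0),(2,0)\}$, $\{(0,2),(1,2),(2,2),(2,1),(1,0)\}$, $\{(0,2),(0,1),(2,1),(0,0),(1,0)\}$, $\{(1,2),(2,2),(0,1),(2,1),(2,0)\}$, $\{(1,2),(0,1),(0,0),(1,0),(2,0)\}$, $\{(0,2),(1,2),(2,2),(0,1),(2,0)\}$, $\{(0,2),(1,2),(0,1),(0,0),(2,0)\}$, $\{(0,2),(2,2),(2,1),(1,0),(2,0)\}$, $\{(0,2),(2,1),(0,0),(1,0),(2,0)\}$, $\{(0,2),(1,2),(2,2),(1,1),(2,0)\}$, $\{(0,2),(2,2),(1,1),(2,1),(2,0)\}$, $\{(0,2),(0,1),(1,1),(0,0),(2,0)\}$, $\{(0,2),(1,1),(0,0),(1,0),(2,0)\}$. Moreover, for each such pattern $p$ and each $n\ge1$, the number of permutations in $S_n$ avoiding $p$ is $(n-1)!\,(n-H_{n-1})$, where $H_m=\sum_{k=1}^m\frac1k$ is the $m$-th harmonic number ($H_0=0$).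
   Context: For $R\subseteq\{0,1,2\}^2$ and $\pi=\pi_1\cdots\pi_n\in S_n$, an occurrence of the mesh pattern $(12,R)$ in $\pi$ is a pair of positions $i_1<i_2$ with $\pi_{i_1}<\pi_{i_2}$ such that, setting $x_0=0,x_1=i_1,x_2=i_2,x_3=n+1$ and $y_0=0,y_1=\pi_{i_1},y_2=\pi_{i_2},y_3=n+1$, for every $(a,b)\in R$ there is no index $k$ with $x_a<k<x_{a+1}$ and $y_b<\pi_k<y_{b+1}$. A permutation avoids $p$ if it has no occurrence of $p$. $s_{n,k}(p)$ is the number of $\pi\in S_n$ with exactly $k$ occurrences of $p$; $p_1,p_2$ are equidistributed if $s_{n,k}(p_1)=s_{n,k}(p_2)$ for all $n,k\ge 0$. -}

module Defs where

open import Data.Nat using (ℕ; zero; suc; _<_; _<ᵇ_; _∸_)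
open import Data.Nat using (_!)
open import Data.Bool using (Bool; true; false; _∧_; not; if_then_else_)
open import Data.Fin using (Fin; toℕ; zero; suc)
open import Data.Fin.Properties using (_≟_)
open import Data.Vec using (Vec; []; _∷_; lookup)
open import Data.List using (List; []; _∷_; length; filter; map; concatMap; allFin)
open import Data.Bool.ListAction using (all; any)
open import Data.Product using (_×_; _,_)
open import Relation.Nullary.Decidable using (⌊_⌋)
open import Data.Integer using (+_)
open import Data.Rational using (ℚ; _+_; _*_; _-_; _/_; 0ℚ)

allVecs : (m n : ℕ) → List (Vec (Fin n) m)
allVecs zero    n = [] ∷ []
allVecs (suc m) n = concatMap (λ i → map (i ∷_) (allVecs m n)) (allFin n)

injective? : ∀ {m n} → Vec (Fin n) m → Bool
injective? {m} v =
  all (λ i → all (λ j → ⌊ i ≟ j ⌋ ∨' not ⌊ lookup v i ≟ lookup v j ⌋) (allFin m)) (allFin m)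
  where
  _∨'_ : Bool → Bool → Bool
  true  ∨' _ = true
  false ∨' b = b

-- S_n : the list of all permutations of [n], in one-line notation
-- (position k ↦ value); position k (0-based Fin) is position toℕ k + 1,
-- value π k is the value toℕ (π k) + 1.
Sn : (n : ℕ) → List (Vec (Fin n) n)
Sn n = filter (λ v → injective? v Data.Bool.≟ true) (allVecs n n)

Mesh : Set
Mesh = List (Fin 3 × Fin 3)

between : ℕ → ℕ → ℕ → Bool
between a k b = (a <ᵇ k) ∧ (k <ᵇ b)

pos : ∀ {n} → Fin n → ℕ
pos k = suc (toℕ k)

val : ∀ {n} → Vec (Fin n) n → Fin n → ℕ
val π k = suc (toℕ (lookup π k))

isOcc : ∀ {n} → Mesh → Vec (Fin n) n → Fin n → Fin n → Bool
isOcc {n} R π i₁ i₂ =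
  (pos i₁ <ᵇ pos i₂) ∧ (val π i₁ <ᵇ val π i₂) ∧
  all (λ { (a , b) → not (any (λ k →
          between (lookup xs (Data.Fin.inject₁ a)) (pos k) (lookup xs (suc a)) ∧
          between (lookup ys (Data.Fin.inject₁ b)) (val π k) (lookup ys (suc b)))
        (allFin n)) }) R
  where
  xs : Vec ℕ 4
  xs = 0 ∷ pos i₁ ∷ pos i₂ ∷ suc n ∷ []
  ys : Vec ℕ 4
  ys = 0 ∷ val π i₁ ∷ val π i₂ ∷ suc n ∷ []

occ : ∀ {n} → Mesh → Vec (Fin n) n → ℕ
occ {n} R π =
  length (filter (λ { (i₁ , i₂) → isOcc R π i₁ i₂ Data.Bool.≟ true })
    (concatMap (λ i → map (i ,_) (allFin n)) (allFin n)))

s : Mesh → ℕ → ℕ → ℕ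
s R n k = length (filter (λ π → occ R π Data.Nat.≟ k) (Sn n))

H : ℕ → ℚ
H zero    = 0ℚ
H (suc m) = H m + (+ 1) / suc m

ℕtoℚ : ℕ → ℚ
ℕtoℚ n = (+ n) / 1

-- The sixteen sets R; coordinates (a , b) with a the horizontal (position)
-- index and b the vertical (value) index.
pattern #0 = zero
pattern #1 = suc zero
pattern #2 = suc (suc zero)

patterns : List Mesh
patterns =
    ((#0 , #2) ∷ (#1 , #2) ∷ (#2 , #2) ∷ (#2 , #1) ∷ (#0 , #0) ∷ [])
  ∷ ((#0 , #2) ∷ (#2 , #2) ∷ (#0 , #1) ∷ (#0 , #0) ∷ (#1 , #0) ∷ [])
  ∷ ((#1 , #2) ∷ (#2 , #2) ∷ (#2 , #1) ∷ (#0 , #0) ∷ (#2 , #0) ∷ [])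
  ∷ ((#2 , #2) ∷ (#0 , #1) ∷ (#0 , #0) ∷ (#1 , #0) ∷ (#2 , #0) ∷ [])
  ∷ ((#0 , #2) ∷ (#1 , #2) ∷ (#2 , #2) ∷ (#2 , #1) ∷ (#1 , #0) ∷ [])
  ∷ ((#0 , #2) ∷ (#0 , #1) ∷ (#2 , #1) ∷ (#0 , #0) ∷ (#1 , #0) ∷ [])
  ∷ ((#1 , #2) ∷ (#2 , #2) ∷ (#0 , #1) ∷ (#2 , #1) ∷ (#2 , #0) ∷ [])
  ∷ ((#1 , #2) ∷ (#0 , #1) ∷ (#0 , #0) ∷ (#1 , #0) ∷ (#2 , #0) ∷ [])
  ∷ ((#0 , #2) ∷ (#1 , #2) ∷ (#2 , #2) ∷ (#0 , #1) ∷ (#2 , #0) ∷ [])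
  ∷ ((#0 , #2) ∷ (#1 , #2) ∷ (#0 , #1) ∷ (#0 , #0) ∷ (#2 , #0) ∷ [])
  ∷ ((#0 , #2) ∷ (#2 , #2) ∷ (#2 , #1) ∷ (#1 , #0) ∷ (#2 , #0) ∷ [])
  ∷ ((#0 , #2) ∷ (#2 , #1) ∷ (#0 , #0) ∷ (#1 , #0) ∷ (#2 , #0) ∷ [])
  ∷ ((#0 , #2) ∷ (#1 , #2) ∷ (#2 , #2) ∷ (#1 , #1) ∷ (#2 , #0) ∷ [])
  ∷ ((#0 , #2) ∷ (#2 , #2) ∷ (#1 , #1) ∷ (#2 , #1) ∷ (#2 , #0) ∷ [])
  ∷ ((#0 , #2) ∷ (#0 , #1) ∷ (#1 , #1) ∷ (#0 , #0) ∷ (#2 , #0) ∷ [])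
  ∷ ((#0 , #2) ∷ (#1 , #1) ∷ (#0 , #0) ∷ (#1 , #0) ∷ (#2 , #0) ∷ [])
  ∷ []

{-# OPTIONS --safe #-}
module Submission where

-- The inverse (transposing the mesh) and the reverse-complement (turning it by a half-turn) are
-- involutions of Sₙ that carry occurrences of (12, R) bijectively to occurrences of the transformed
-- pattern; they split the list into four classes with representatives R₁, R₅, R₉, R₁₃.  These four
-- shade the whole top row, which forces every occurrence (i, j) to end at the maximum, π(j) = n.
-- Reversing the values below n then swaps the two lower rows of the mesh (R₁ ↦ R₉), and reversing
-- the entries before the position of n swaps the two left columns (R₁ ↦ R₅, R₉ ↦ R₁₃), again
-- bijectively on occurrences.
--
-- A permutation contains R₅ iff π(q+1) = n for some q with every entry after q+1 below π(q).  Write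
-- π ∈ S_{n+2} as its first entry v followed by σ ∈ S_{n+1}; then π avoids R₅ iff v is the maximum,
-- or σ avoids R₅ and (σ(1), v) ≠ (n+1, n+1).  Summing over v and σ gives
-- a(n+2) + n! = (n+1)! + (n+1)·a(n+1) for the number a(n) of avoiders, which with a(1) = 1 is solved
-- by a(n+1) = n!·(n+1 − Hₙ).

module MeshPatterns where

  open import Defs
  open import Data.Bool using (Bool; true; false; T; not; _∧_)
  import Data.Bool as Bool
  open import Data.Bool.ListAction using (and; all; any)
  open import Data.Bool.Properties using (T-≡; T-∧; ∧-assoc; ∧-comm)
  open import Data.Empty using (⊥; ⊥-elim)
  open import Data.Fin using (Fin; zero; suc; toℕ; fromℕ; fromℕ<; inject₁; opposite; punchIn; punchOut)
  open import Data.Fin.Properties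
    using ( _≟_; any?; suc-injective; toℕ-injective; toℕ<n; toℕ-fromℕ; toℕ-fromℕ<; toℕ-inject₁
          ; opposite-prop; opposite-involutive; injective⇒≤; punchOut-injective
          ; punchIn-injective; punchInᵢ≢i; punchIn-mono-≤ )
  open import Data.List
    using ( List; []; _∷_; _++_; map; concatMap; filter; length; allFin
          ; cartesianProductWith; cartesianProduct )
  open import Data.List.Membership.Propositional using (_∈_; _∉_)
  open import Data.List.Membership.Propositional.Properties
    using ( ∈-map⁺; ∈-filter⁺; ∈-filter⁻; ∈-allFin
          ; ∈-cartesianProductWith⁺; ∈-cartesianProduct⁺; ∈-cartesianProduct⁻ )
  open import Data.List.Properties using (map-++; map-cong; map-∘; length-tabulate)
  open import Data.List.Relation.Binary.Subset.Propositional using (_⊆_)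
  import Data.List.Relation.Binary.Subset.DecPropositional as DecSubset
  open import Data.List.Relation.Unary.All using (All; []; _∷_)
  import Data.List.Relation.Unary.All as All
  import Data.List.Relation.Unary.All.Properties as All
  open import Data.List.Relation.Unary.All.Properties using (all-anti-mono)
  open import Data.List.Relation.Unary.All.Properties.Core using (¬All⇒Any¬)
  open import Data.List.Relation.Unary.AllPairs using ([]; _∷_)
  open import Data.List.Relation.Unary.Any using (here; there)
  import Data.List.Relation.Unary.Any as Any
  import Data.List.Relation.Unary.Any.Properties as Any
  open import Data.List.Relation.Unary.Unique.Propositional using (Unique)
  import Data.List.Relation.Unary.Unique.Propositional.Properties as Unique
  open import Data.Nat
    using ( ℕ; zero; suc; _!; _+_; _*_; _∸_; _≤_; _<_; _<?_; _<ᵇ_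
          ; s≤s; s≤s⁻¹; z<s; s<s; s<s⁻¹ )
  import Data.Nat as ℕ
  open import Data.Nat.ListAction using (sum)
  open import Data.Nat.ListAction.Properties using (sum-++)
  open import Data.Nat.Properties
    using ( +-comm; +-suc; +-identityʳ; +-cancelʳ-≡; +-mono-<-≤; +-commutativeSemigroup
          ; *-comm; *-identityʳ; *-zeroʳ; *-distribˡ-+; +-∸-assoc; m∸n≤m; m∸n+n≡m; n∸n≡0
          ; ∸-monoʳ-<; ∸-cancelʳ-<; m+n≡0⇒n≡0; 1+n≢n; 1+n≰n
          ; ≤-refl; ≤-reflexive; ≤-pred; m≤n⇒m≤1+n; <⇒≤; <-irrefl; <-asym; <-trans
          ; ≤-<-trans; <-≤-trans; <-cmp; m<m+n; ≤∧≢⇒<; ≮⇒≥; ≰⇒>; <⇒≱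
          ; <ᵇ⇒<; <⇒<ᵇ )
  open import Data.Product using (_×_; _,_; proj₁; proj₂; ∃; uncurry)
  import Data.Product as ×
  open import Data.Product.Properties using () renaming (≡-dec to ×-≡-dec)
  open import Data.Sum using (_⊎_; inj₁; inj₂; [_,_])
  open import Data.Vec using (Vec; []; _∷_; lookup; tabulate)
  import Data.Vec as Vec
  open import Data.Vec.Properties
    using (∷-injective; ≡-dec; lookup-map; lookup∘tabulate; tabulate∘lookup; tabulate-cong)
  import Data.Vec.Properties as Vec
  open import Function using (id; _∘_; case_of_; Injective; Equivalence)
  open import Level using (0ℓ)
  open import Relation.Binary.Definitions using (DecidableEquality; Tri; tri<; tri≈; tri>)
  open import Relation.Binary.PropositionalEquality
    using (_≡_; _≢_; refl; sym; trans; cong; cong₂; subst; subst₂; module ≡-Reasoning)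
  open import Relation.Nullary using (¬_; yes; no; ¬?)
  open import Relation.Nullary.Decidable using (Dec; ⌊_⌋; T?; True; toWitness; map′)
  open import Relation.Unary using (Pred; Decidable)

  open import Algebra.Properties.CommutativeSemigroup +-commutativeSemigroup
    using () renaming (interchange to +-interchange; x∙yz≈y∙xz to +-exchange)

  open ≡-Reasoning

  private variable
    A B C : Set

  T-ext : {a b : Bool} → (T a → T b) → (T b → T a) → a ≡ b
  T-ext {false} {false} _ _ = refl
  T-ext {false} {true}  _ g = ⊥-elim (g _)
  T-ext {true}  {false} f _ = ⊥-elim (f _)
  T-ext {true}  {true}  _ _ = refl

  ¬T⇒≡ : {a b : Bool} → ¬ T a → ¬ T b → a ≡ b
  ¬T⇒≡ ¬a ¬b = T-ext (⊥-elim ∘ ¬a) (⊥-elim ∘ ¬b)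

  T-not⁻ : ∀ {b} → T (not b) → ¬ T b
  T-not⁻ {false} _ ()

  T-not⁺ : ∀ {b} → ¬ T b → T (not b)
  T-not⁺ {false} _  = _
  T-not⁺ {true}  ¬t = ¬t _

  T⇒≡true : ∀ {b} → T b → b ≡ true
  T⇒≡true = Equivalence.to T-≡

  all-allFin⁻ : ∀ {n} (p : Fin n → Bool) → T (all p (allFin n)) → ∀ i → T (p i)
  all-allFin⁻ p h i = All.lookup (All.all⁺ p _ h) (∈-allFin i)

  ¬all-allFin⁻ : ∀ {n} (p : Fin n → Bool) → ¬ T (all p (allFin n)) → ∃ λ i → ¬ T (p i)
  ¬all-allFin⁻ {n} p ¬t = Any.satisfied (¬All⇒Any¬ (T? ∘ p) (allFin n) (¬t ∘ All.all⁻ p))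

  any-allFin⁻ : ∀ {n} (p : Fin n → Bool) → T (any p (allFin n)) → ∃ λ i → T (p i)
  any-allFin⁻ {n} p h = Any.satisfied (Any.any⁻ p (allFin n) h)

  any-allFin⁺ : ∀ {n} (p : Fin n → Bool) (i : Fin n) → T (p i) → T (any p (allFin n))
  any-allFin⁺ p i pi = Any.any⁺ p (Any.map (λ { refl → pi }) (∈-allFin i))

  all-map-cong : (f : A → Bool) (g : B → Bool) (t : A → B) → (∀ x → g (t x) ≡ f x) →
                 ∀ xs → all f xs ≡ all g (map t xs)
  all-map-cong f g t g∘t≗f xs = cong and (trans (map-cong (sym ∘ g∘t≗f) xs) (map-∘ xs))

  any-allFin-reindex : ∀ {n} (p q : Fin n → Bool) (τ τ⁻¹ : Fin n → Fin n) →
    (∀ k → τ (τ⁻¹ k) ≡ k) → (∀ k → q (τ k) ≡ p k) → any p (allFin n) ≡ any q (allFin n)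
  any-allFin-reindex p q τ τ⁻¹ τ∘τ⁻¹ q∘τ≗p = T-ext
    (λ t → let k , pk = any-allFin⁻ p t in any-allFin⁺ q (τ k) (subst T (sym (q∘τ≗p k)) pk))
    (λ t → let k , qk = any-allFin⁻ q t in
      any-allFin⁺ p (τ⁻¹ k) (subst T (trans (cong q (sym (τ∘τ⁻¹ k))) (q∘τ≗p (τ⁻¹ k))) qk))

  𝟙 : Bool → ℕ
  𝟙 true  = 1
  𝟙 false = 0

  ∑ : (A → ℕ) → List A → ℕ
  ∑ F xs = sum (map F xs)

  length-filter≡∑ : {P : Pred A 0ℓ} (P? : Decidable P) (xs : List A) →
                    length (filter P? xs) ≡ ∑ (λ x → 𝟙 ⌊ P? x ⌋) xs
  length-filter≡∑ P? []       = refl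
  length-filter≡∑ P? (x ∷ xs) with P? x
  ... | yes _ = cong suc (length-filter≡∑ P? xs)
  ... | no  _ = length-filter≡∑ P? xs

  ∑-cong : {F G : A → ℕ} (xs : List A) → (∀ {x} → x ∈ xs → F x ≡ G x) → ∑ F xs ≡ ∑ G xs
  ∑-cong []       F≗G = refl
  ∑-cong (x ∷ xs) F≗G = cong₂ _+_ (F≗G (here refl)) (∑-cong xs (F≗G ∘ there))

  ∑-++ : (F : A → ℕ) (xs ys : List A) → ∑ F (xs ++ ys) ≡ ∑ F xs + ∑ F ys
  ∑-++ F xs ys = trans (cong sum (map-++ F xs ys)) (sum-++ (map F xs) (map F ys))

  ∑-+ : (F G : A → ℕ) (xs : List A) → ∑ (λ x → F x + G x) xs ≡ ∑ F xs + ∑ G xs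
  ∑-+ F G []       = refl
  ∑-+ F G (x ∷ xs) = trans (cong (F x + G x +_) (∑-+ F G xs)) (+-interchange (F x) (G x) _ _)

  ∑-*ˡ : (c : ℕ) (F : A → ℕ) (xs : List A) → ∑ (λ x → c * F x) xs ≡ c * ∑ F xs
  ∑-*ˡ c F []       = sym (*-zeroʳ c)
  ∑-*ˡ c F (x ∷ xs) = trans (cong (c * F x +_) (∑-*ˡ c F xs)) (sym (*-distribˡ-+ c (F x) _))

  ∑-1≡length : (xs : List A) → ∑ (λ _ → 1) xs ≡ length xs
  ∑-1≡length []       = refl
  ∑-1≡length (x ∷ xs) = cong suc (∑-1≡length xs)

  ∑-map : (F : B → ℕ) (f : A → B) (xs : List A) → ∑ F (map f xs) ≡ ∑ (F ∘ f) xs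
  ∑-map F f []       = refl
  ∑-map F f (x ∷ xs) = cong (F (f x) +_) (∑-map F f xs)

  ∑-comm : (F : A → B → ℕ) (xs : List A) (ys : List B) →
           ∑ (λ x → ∑ (F x) ys) xs ≡ ∑ (λ y → ∑ (λ x → F x y) xs) ys
  ∑-comm F []       ys = sym (∑-zero ys)
    where
    ∑-zero : (ys : List B) → ∑ (λ _ → 0) ys ≡ 0
    ∑-zero []       = refl
    ∑-zero (y ∷ ys) = ∑-zero ys
  ∑-comm F (x ∷ xs) ys =
    trans (cong (∑ (F x) ys +_) (∑-comm F xs ys)) (sym (∑-+ (F x) (λ y → ∑ (λ x → F x y) xs) ys))

  ∑-cartesianProductWith : (F : C → ℕ) (f : A → B → C) (xs : List A) (ys : List B) →
    ∑ F (cartesianProductWith f xs ys) ≡ ∑ (λ x → ∑ (F ∘ f x) ys) xs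
  ∑-cartesianProductWith F f []       ys = refl
  ∑-cartesianProductWith F f (x ∷ xs) ys = begin
    ∑ F (map (f x) ys ++ cartesianProductWith f xs ys)
      ≡⟨ ∑-++ F (map (f x) ys) _ ⟩
    ∑ F (map (f x) ys) + ∑ F (cartesianProductWith f xs ys)
      ≡⟨ cong₂ _+_ (∑-map F (f x) ys) (∑-cartesianProductWith F f xs ys) ⟩
    ∑ (F ∘ f x) ys + ∑ (λ x → ∑ (F ∘ f x) ys) xs ∎

  ∑-𝟙≡0 : (p : A → Bool) {xs : List A} → ∑ (𝟙 ∘ p) xs ≡ 0 → ∀ {x} → x ∈ xs → ¬ T (p x)
  ∑-𝟙≡0 p {y ∷ ys} sum≡0 (here refl) px with p y
  ... | true  = case sum≡0 of λ ()
  ... | false = px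
  ∑-𝟙≡0 p {y ∷ ys} sum≡0 (there x∈) px = ∑-𝟙≡0 p (m+n≡0⇒n≡0 (𝟙 (p y)) sum≡0) x∈ px

  ∑-𝟙≢0 : (p : A → Bool) (xs : List A) → ∑ (𝟙 ∘ p) xs ≢ 0 → ∃ λ x → T (p x)
  ∑-𝟙≢0 p []       sum≢0 = ⊥-elim (sum≢0 refl)
  ∑-𝟙≢0 p (x ∷ xs) sum≢0 with p x in px
  ... | true  = x , subst T (sym px) _
  ... | false = ∑-𝟙≢0 p xs sum≢0

  module _ (_≟_ : DecidableEquality B) where

    private
      _without_ : List B → B → List B
      ys without y = filter (λ z → ¬? (z ≟ y)) ys

      without-∉ : ∀ {y} ys → y ∉ ys → ys without y ≡ ys
      without-∉ {y} []       _  = refl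
      without-∉ {y} (z ∷ zs) y∉ with z ≟ y
      ... | yes refl = ⊥-elim (y∉ (here refl))
      ... | no  _    = cong (z ∷_) (without-∉ zs (y∉ ∘ there))

    ∑-extract : (G : B → ℕ) {ys : List B} → Unique ys → ∀ {y} → y ∈ ys →
                ∑ G ys ≡ G y + ∑ G (ys without y)
    ∑-extract G {z ∷ ys} (z∉ys ∷ u) (here refl) with z ≟ z
    ... | yes _   =
      cong (λ zs → G z + ∑ G zs) (sym (without-∉ ys (Unique.Unique[x∷xs]⇒x∉xs (z∉ys ∷ u))))
    ... | no  z≢z = ⊥-elim (z≢z refl)
    ∑-extract G {z ∷ ys} (z∉ys ∷ u) {y} (there y∈ys) with z ≟ y
    ... | yes refl = ⊥-elim (Unique.Unique[x∷xs]⇒x∉xs (z∉ys ∷ u) y∈ys)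
    ... | no  _    = trans (cong (G z +_) (∑-extract G u y∈ys)) (+-exchange (G z) (G y) _)

    ∑-𝟙-≟-∉ : ∀ {x ys} → x ∉ ys → ∑ (λ y → 𝟙 ⌊ y ≟ x ⌋) ys ≡ 0
    ∑-𝟙-≟-∉ {x} {[]}     _  = refl
    ∑-𝟙-≟-∉ {x} {y ∷ ys} x∉ with y ≟ x
    ... | yes refl = ⊥-elim (x∉ (here refl))
    ... | no  _    = ∑-𝟙-≟-∉ (x∉ ∘ there)

    ∑-𝟙-≟ : ∀ {ys} → Unique ys → ∀ {x} → x ∈ ys → ∑ (λ y → 𝟙 ⌊ y ≟ x ⌋) ys ≡ 1
    ∑-𝟙-≟ {y ∷ ys} (y∉ys ∷ u) (here refl) with y ≟ y
    ... | yes _   = cong suc (∑-𝟙-≟-∉ (Unique.Unique[x∷xs]⇒x∉xs (y∉ys ∷ u)))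
    ... | no  y≢y = ⊥-elim (y≢y refl)
    ∑-𝟙-≟ {y ∷ ys} (y∉ys ∷ u) {x} (there x∈ys) with y ≟ x
    ... | yes refl = ⊥-elim (Unique.Unique[x∷xs]⇒x∉xs (y∉ys ∷ u) x∈ys)
    ... | no  _    = ∑-𝟙-≟ u x∈ys

    ∑-bijection : (G : B → ℕ) (f : A → B) (g : B → A) {xs : List A} {ys : List B} →
      Unique xs → Unique ys →
      (∀ {x} → x ∈ xs → f x ∈ ys) → (∀ {y} → y ∈ ys → g y ∈ xs) →
      (∀ {x} → x ∈ xs → g (f x) ≡ x) → (∀ {y} → y ∈ ys → f (g y) ≡ y) →
      ∑ (G ∘ f) xs ≡ ∑ G ys
    ∑-bijection G f g {[]} {[]} _ _ _ _ _ _ = refl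
    ∑-bijection G f g {[]} {y ∷ ys} _ _ _ g∈ _ _ with g∈ (here refl)
    ... | ()
    ∑-bijection G f g {x ∷ xs} {ys} (x∉xs ∷ ux) uy f∈ g∈ gf fg =
      trans (cong (G (f x) +_) rest) (sym (∑-extract G uy (f∈ (here refl))))
      where
      fx∉ : ∀ {x′} → x′ ∈ xs → f x′ ≢ f x
      fx∉ {x′} x′∈ eq = Unique.Unique[x∷xs]⇒x∉xs (x∉xs ∷ ux)
        (subst (_∈ xs) (trans (sym (gf (there x′∈))) (trans (cong g eq) (gf (here refl)))) x′∈)
      gy∈xs : ∀ {y} → y ∈ ys without f x → g y ∈ xs
      gy∈xs y∈ with ∈-filter⁻ (λ z → ¬? (z ≟ f x)) y∈
      ... | y∈ys , y≢fx with g∈ y∈ys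
      ...   | here gy≡x = ⊥-elim (y≢fx (trans (sym (fg y∈ys)) (cong f gy≡x)))
      ...   | there gy∈ = gy∈
      rest : ∑ (G ∘ f) xs ≡ ∑ G (ys without f x)
      rest = ∑-bijection G f g ux (Unique.filter⁺ (λ z → ¬? (z ≟ f x)) uy)
        (λ x′∈ → ∈-filter⁺ (λ z → ¬? (z ≟ f x)) (f∈ (there x′∈)) (fx∉ x′∈))
        gy∈xs (gf ∘ there) (fg ∘ proj₁ ∘ ∈-filter⁻ (λ z → ¬? (z ≟ f x)))

  ∑-allFin-1 : ∀ N → ∑ (λ _ → 1) (allFin N) ≡ N
  ∑-allFin-1 N = trans (∑-1≡length (allFin N)) (length-tabulate id)

  ∑-allFin-≟ : ∀ {N} (x : Fin N) → ∑ (λ v → 𝟙 ⌊ v ≟ x ⌋) (allFin N) ≡ 1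
  ∑-allFin-≟ {N} x = ∑-𝟙-≟ _≟_ (Unique.allFin⁺ N) (∈-allFin x)

  𝟙-not+𝟙 : ∀ b → 𝟙 (not b) + 𝟙 b ≡ 1
  𝟙-not+𝟙 true  = refl
  𝟙-not+𝟙 false = refl

  ∑-allFin-≢ : ∀ {N} (x : Fin N) → ∑ (λ v → 𝟙 (not ⌊ v ≟ x ⌋)) (allFin N) + 1 ≡ N
  ∑-allFin-≢ {N} x = begin
    ∑ (λ v → 𝟙 (not ⌊ v ≟ x ⌋)) (allFin N) + 1
      ≡⟨ cong (∑ (λ v → 𝟙 (not ⌊ v ≟ x ⌋)) (allFin N) +_) (∑-allFin-≟ x) ⟨
    ∑ (λ v → 𝟙 (not ⌊ v ≟ x ⌋)) (allFin N) + ∑ (λ v → 𝟙 ⌊ v ≟ x ⌋) (allFin N)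
      ≡⟨ ∑-+ (λ v → 𝟙 (not ⌊ v ≟ x ⌋)) (λ v → 𝟙 ⌊ v ≟ x ⌋) (allFin N) ⟨
    ∑ (λ v → 𝟙 (not ⌊ v ≟ x ⌋) + 𝟙 ⌊ v ≟ x ⌋) (allFin N)
      ≡⟨ ∑-cong (allFin N) (λ {v} _ → 𝟙-not+𝟙 ⌊ v ≟ x ⌋) ⟩
    ∑ (λ _ → 1) (allFin N)
      ≡⟨ ∑-allFin-1 N ⟩
    N ∎

  concatMap-map≡cartesianProductWith : (f : A → B → C) (xs : List A) (ys : List B) →
    concatMap (λ x → map (f x) ys) xs ≡ cartesianProductWith f xs ys
  concatMap-map≡cartesianProductWith f []       ys = refl
  concatMap-map≡cartesianProductWith f (x ∷ xs) ys =
    cong (map (f x) ys ++_) (concatMap-map≡cartesianProductWith f xs ys)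

  ∈-allVecs : ∀ m n (v : Vec (Fin n) m) → v ∈ allVecs m n
  ∈-allVecs zero    n []      = here refl
  ∈-allVecs (suc m) n (a ∷ v) =
    subst (a ∷ v ∈_) (sym (concatMap-map≡cartesianProductWith _∷_ (allFin n) (allVecs m n)))
      (∈-cartesianProductWith⁺ _∷_ (∈-allFin a) (∈-allVecs m n v))

  allVecs-unique : ∀ m n → Unique (allVecs m n)
  allVecs-unique zero    n = All.[] ∷ []
  allVecs-unique (suc m) n =
    subst Unique (sym (concatMap-map≡cartesianProductWith _∷_ (allFin n) (allVecs m n)))
      (Unique.cartesianProductWith⁺ _∷_ ∷-injective (Unique.allFin⁺ n) (allVecs-unique m n))

  injective?-sound : ∀ {m n} (v : Vec (Fin n) m) → T (injective? v) → Injective _≡_ _≡_ (lookup v)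
  injective?-sound v h {i} {j} vi≡vj with all-allFin⁻ _ (all-allFin⁻ _ h i) j
  ... | h-ij with i ≟ j
  ...   | yes i≡j = i≡j
  ...   | no  _   with lookup v i ≟ lookup v j
  ...     | yes _    = ⊥-elim h-ij
  ...     | no vi≢vj = ⊥-elim (vi≢vj vi≡vj)

  injective?-complete : ∀ {m n} (v : Vec (Fin n) m) → Injective _≡_ _≡_ (lookup v) → T (injective? v)
  injective?-complete {m} v inj with T? (injective? v)
  ... | yes t = t
  ... | no ¬t with ¬all-allFin⁻ {m} _ ¬t
  ...   | i , ¬tᵢ with ¬all-allFin⁻ {m} _ ¬tᵢ
  ...     | j , ¬tᵢⱼ with i ≟ j
  ...       | yes _   = ⊥-elim (¬tᵢⱼ _)
  ...       | no  i≢j with lookup v i ≟ lookup v j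
  ...         | yes vi≡vj = ⊥-elim (i≢j (inj vi≡vj))
  ...         | no  _     = ⊥-elim (¬tᵢⱼ _)

  record IsPermutation {n} (π : Vec (Fin n) n) : Set where
    constructor isPermutation
    field injective : Injective _≡_ _≡_ (lookup π)

  open IsPermutation public

  ∈-Sn⁺ : ∀ {n} {π : Vec (Fin n) n} → IsPermutation π → π ∈ Sn n
  ∈-Sn⁺ {n} {π} perm = ∈-filter⁺ (λ v → injective? v Bool.≟ true) (∈-allVecs n n π)
    (Equivalence.to T-≡ (injective?-complete π (injective perm)))

  ∈-Sn⁻ : ∀ {n} {π : Vec (Fin n) n} → π ∈ Sn n → IsPermutation π
  ∈-Sn⁻ {n} {π} π∈ = isPermutation (injective?-sound π (Equivalence.from T-≡
    (proj₂ (∈-filter⁻ (λ v → injective? v Bool.≟ true) {xs = allVecs n n} π∈))))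

  Sn-unique : ∀ n → Unique (Sn n)
  Sn-unique n = Unique.filter⁺ (λ v → injective? v Bool.≟ true) (allVecs-unique n n)

  perm⇒surjective : ∀ {n} {π : Vec (Fin n) n} → IsPermutation π →
                    ∀ y → ∃ λ x → lookup π x ≡ y
  perm⇒surjective {suc n} {π} perm y with any? (λ x → lookup π x ≟ y)
  ... | yes hit = hit
  ... | no miss = ⊥-elim (1+n≰n (injective⇒≤ squeeze-injective))
    where
    y≢π : ∀ x → y ≢ lookup π x
    y≢π x y≡πx = miss (x , sym y≡πx)
    squeeze : Fin (suc n) → Fin n
    squeeze x = punchOut (y≢π x)
    squeeze-injective : Injective _≡_ _≡_ squeeze
    squeeze-injective {x} {x′} = injective perm ∘ punchOut-injective (y≢π x) (y≢π x′)

  -- The fallback y is never reached when π is a permutation.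
  preimage : ∀ {n} → Vec (Fin n) n → Fin n → Fin n
  preimage π y with any? (λ x → lookup π x ≟ y)
  ... | yes (x , _) = x
  ... | no  _       = y

  inverse : ∀ {n} → Vec (Fin n) n → Vec (Fin n) n
  inverse π = tabulate (preimage π)

  tabulate-≗lookup : ∀ {n} {f : Fin n → A} {v : Vec A n} →
                     (∀ k → f k ≡ lookup v k) → tabulate f ≡ v
  tabulate-≗lookup {v = v} f≗v = trans (tabulate-cong f≗v) (tabulate∘lookup v)

  module _ {n} {π : Vec (Fin n) n} (perm : IsPermutation π) where

    lookup-preimage : ∀ y → lookup π (preimage π y) ≡ y
    lookup-preimage y with any? (λ x → lookup π x ≟ y)
    ... | yes (_ , πx≡y) = πx≡y
    ... | no  miss       = ⊥-elim (miss (perm⇒surjective perm y))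

    inverseʳ : ∀ y → lookup π (lookup (inverse π) y) ≡ y
    inverseʳ y = trans (cong (lookup π) (lookup∘tabulate (preimage π) y)) (lookup-preimage y)

    inverseˡ : ∀ x → lookup (inverse π) (lookup π x) ≡ x
    inverseˡ x = injective perm (inverseʳ (lookup π x))

    inverse-perm : IsPermutation (inverse π)
    inverse-perm = isPermutation λ {y} {y′} eq →
      trans (sym (inverseʳ y)) (trans (cong (lookup π) eq) (inverseʳ y′))

  inverse-involutive : ∀ {n} {π : Vec (Fin n) n} → IsPermutation π → inverse (inverse π) ≡ π
  inverse-involutive perm = tabulate-≗lookup λ x →
    injective (inverse-perm perm) (trans (lookup-preimage (inverse-perm perm) x) (sym (inverseˡ perm x)))

  pairs : ∀ n → List (Fin n × Fin n)
  pairs n = cartesianProduct (allFin n) (allFin n)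

  𝟙-≟true : ∀ b → 𝟙 ⌊ b Bool.≟ true ⌋ ≡ 𝟙 b
  𝟙-≟true true  = refl
  𝟙-≟true false = refl

  occ≡∑ : ∀ {n} R (π : Vec (Fin n) n) → occ R π ≡ ∑ (𝟙 ∘ uncurry (isOcc R π)) (pairs n)
  occ≡∑ {n} R π = begin
    occ R π
      ≡⟨ length-filter≡∑ _ allPairs ⟩
    ∑ (λ p → 𝟙 ⌊ uncurry (isOcc R π) p Bool.≟ true ⌋) allPairs
      ≡⟨ ∑-cong allPairs (λ {p} _ → 𝟙-≟true (uncurry (isOcc R π) p)) ⟩
    ∑ (𝟙 ∘ uncurry (isOcc R π)) allPairs
      ≡⟨ cong (∑ _) (concatMap-map≡cartesianProductWith _,_ (allFin n) (allFin n)) ⟩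
    ∑ (𝟙 ∘ uncurry (isOcc R π)) (pairs n) ∎
    where
    allPairs : List (Fin n × Fin n)
    allPairs = concatMap (λ i → map (i ,_) (allFin n)) (allFin n)

  occ≡0⇒¬isOcc : ∀ {n} R (π : Vec (Fin n) n) → occ R π ≡ 0 → ∀ i j → ¬ T (isOcc R π i j)
  occ≡0⇒¬isOcc R π occ≡0 i j =
    ∑-𝟙≡0 (uncurry (isOcc R π)) (trans (sym (occ≡∑ R π)) occ≡0)
      (∈-cartesianProduct⁺ (∈-allFin i) (∈-allFin j))

  occ≢0⇒isOcc : ∀ {n} R (π : Vec (Fin n) n) → occ R π ≢ 0 →
                ∃ λ (p : Fin n × Fin n) → T (uncurry (isOcc R π) p)
  occ≢0⇒isOcc {n} R π occ≢0 = ∑-𝟙≢0 (uncurry (isOcc R π)) (pairs n) (occ≢0 ∘ trans (occ≡∑ R π))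

  occ-bijection : ∀ {n} R R′ {π π′ : Vec (Fin n) n} (f g : Fin n × Fin n → Fin n × Fin n) →
    (∀ p → g (f p) ≡ p) → (∀ p → f (g p) ≡ p) →
    (∀ i j → isOcc R π i j ≡ uncurry (isOcc R′ π′) (f (i , j))) →
    occ R π ≡ occ R′ π′
  occ-bijection {n} R R′ {π} {π′} f g gf fg occ≡ = begin
    occ R π                                  ≡⟨ occ≡∑ R π ⟩
    ∑ (𝟙 ∘ uncurry (isOcc R π)) (pairs n)
      ≡⟨ ∑-cong (pairs n) (λ {p} _ → cong 𝟙 (occ≡ (proj₁ p) (proj₂ p))) ⟩
    ∑ (𝟙 ∘ uncurry (isOcc R′ π′) ∘ f) (pairs n)
      ≡⟨ ∑-bijection (×-≡-dec _≟_ _≟_) (𝟙 ∘ uncurry (isOcc R′ π′)) f g pairs-unique pairs-unique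
           (λ _ → ∈-pairs _) (λ _ → ∈-pairs _) (λ {p} _ → gf p) (λ {p} _ → fg p) ⟩
    ∑ (𝟙 ∘ uncurry (isOcc R′ π′)) (pairs n)  ≡⟨ occ≡∑ R′ π′ ⟨
    occ R′ π′                                ∎
    where
    pairs-unique : Unique (pairs n)
    pairs-unique = Unique.cartesianProduct⁺ (Unique.allFin⁺ n) (Unique.allFin⁺ n)
    ∈-pairs : ∀ p → p ∈ pairs n
    ∈-pairs (i , j) = ∈-cartesianProduct⁺ (∈-allFin i) (∈-allFin j)

  s≡∑ : ∀ R n k → s R n k ≡ ∑ (λ π → 𝟙 ⌊ occ R π ℕ.≟ k ⌋) (Sn n)
  s≡∑ R n k = length-filter≡∑ _ (Sn n)

  s-involution : ∀ R R′ n (f : Vec (Fin n) n → Vec (Fin n) n) →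
    (∀ {π} → IsPermutation π → IsPermutation (f π)) →
    (∀ {π} → IsPermutation π → f (f π) ≡ π) →
    (∀ {π} → IsPermutation π → occ R π ≡ occ R′ (f π)) →
    ∀ k → s R n k ≡ s R′ n k
  s-involution R R′ n f f-perm f-invol f-occ k = begin
    s R n k                                  ≡⟨ s≡∑ R n k ⟩
    ∑ (λ π → 𝟙 ⌊ occ R π ℕ.≟ k ⌋) (Sn n)
      ≡⟨ ∑-cong (Sn n) (λ π∈ → cong (λ m → 𝟙 ⌊ m ℕ.≟ k ⌋) (f-occ (∈-Sn⁻ π∈))) ⟩
    ∑ (λ π → 𝟙 ⌊ occ R′ (f π) ℕ.≟ k ⌋) (Sn n)
      ≡⟨ ∑-bijection (≡-dec _≟_) (λ π → 𝟙 ⌊ occ R′ π ℕ.≟ k ⌋) f f (Sn-unique n) (Sn-unique n)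
           f∈ f∈ (f-invol ∘ ∈-Sn⁻) (f-invol ∘ ∈-Sn⁻) ⟩
    ∑ (λ π → 𝟙 ⌊ occ R′ π ℕ.≟ k ⌋) (Sn n)   ≡⟨ s≡∑ R′ n k ⟨
    s R′ n k                                 ∎
    where
    f∈ : ∀ {π} → π ∈ Sn n → f π ∈ Sn n
    f∈ = ∈-Sn⁺ ∘ f-perm ∘ ∈-Sn⁻

  Cell : Set
  Cell = Fin 3 × Fin 3

  -- bs lists the boundaries 0 < b₁ < b₂ < n+1 of the three strips of the mesh picture.
  inGap : Vec ℕ 4 → Fin 3 → ℕ → Bool
  inGap bs a x = between (lookup bs (inject₁ a)) x (lookup bs (suc a))

  xBounds : ∀ {n} → Fin n → Fin n → Vec ℕ 4
  xBounds {n} i j = 0 ∷ pos i ∷ pos j ∷ suc n ∷ []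

  yBounds : ∀ {n} → Vec (Fin n) n → Fin n → Fin n → Vec ℕ 4
  yBounds {n} π i j = 0 ∷ val π i ∷ val π j ∷ suc n ∷ []

  inCell : ∀ {n} → Vec (Fin n) n → Fin n → Fin n → Cell → Fin n → Bool
  inCell π i j (a , b) k = inGap (xBounds i j) a (pos k) ∧ inGap (yBounds π i j) b (val π k)

  cellEmpty : ∀ {n} → Vec (Fin n) n → Fin n → Fin n → Cell → Bool
  cellEmpty {n} π i j c = not (any (inCell π i j c) (allFin n))

  between⁺ : ∀ {a x b} → a < x → x < b → T (between a x b)
  between⁺ a<x x<b = Equivalence.from T-∧ (<⇒<ᵇ a<x , <⇒<ᵇ x<b)

  between⁻ : ∀ a x b → T (between a x b) → a < x × x < b
  between⁻ a x b t = let ax , xb = Equivalence.to T-∧ t in <ᵇ⇒< a x ax , <ᵇ⇒< x b xb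

  isOcc-transport : ∀ {n} R (t : Cell → Cell) (π : Vec (Fin n) n) (i j : Fin n)
    (π′ : Vec (Fin n) n) (i′ j′ : Fin n) (τ τ⁻¹ : Fin n → Fin n) → (∀ k → τ (τ⁻¹ k) ≡ k) →
    (pos i <ᵇ pos j) ∧ (val π i <ᵇ val π j) ≡ (pos i′ <ᵇ pos j′) ∧ (val π′ i′ <ᵇ val π′ j′) →
    (∀ c k → inCell π′ i′ j′ (t c) (τ k) ≡ inCell π i j c k) →
    isOcc R π i j ≡ isOcc (map t R) π′ i′ j′
  isOcc-transport R t π i j π′ i′ j′ τ τ⁻¹ τ∘τ⁻¹ orders≡ cells≡ = begin
    (pos i <ᵇ pos j) ∧ (val π i <ᵇ val π j) ∧ all (cellEmpty π i j) R
      ≡⟨ ∧-assoc (pos i <ᵇ pos j) _ _ ⟨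
    ((pos i <ᵇ pos j) ∧ (val π i <ᵇ val π j)) ∧ all (cellEmpty π i j) R
      ≡⟨ cong₂ _∧_ orders≡ (all-map-cong (cellEmpty π i j) (cellEmpty π′ i′ j′) t empties≡ R) ⟩
    ((pos i′ <ᵇ pos j′) ∧ (val π′ i′ <ᵇ val π′ j′)) ∧ all (cellEmpty π′ i′ j′) (map t R)
      ≡⟨ ∧-assoc (pos i′ <ᵇ pos j′) _ _ ⟩
    (pos i′ <ᵇ pos j′) ∧ (val π′ i′ <ᵇ val π′ j′) ∧ all (cellEmpty π′ i′ j′) (map t R) ∎
    where
    empties≡ : ∀ c → cellEmpty π′ i′ j′ (t c) ≡ cellEmpty π i j c
    empties≡ c = cong not (sym (any-allFin-reindex _ _ τ τ⁻¹ τ∘τ⁻¹ (cells≡ c)))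

  record Occurrence {n} (R : Mesh) (π : Vec (Fin n) n) (i j : Fin n) : Set where
    field
      pos< : pos i < pos j
      val< : val π i < val π j
      empty : ∀ {a b} → (a , b) ∈ R → ∀ k →
              T (inGap (xBounds i j) a (pos k)) → ¬ T (inGap (yBounds π i j) b (val π k))

  module _ {n} (R : Mesh) (π : Vec (Fin n) n) (i j : Fin n) where

    isOcc⇒Occurrence : T (isOcc R π i j) → Occurrence R π i j
    isOcc⇒Occurrence t = record
      { pos< = <ᵇ⇒< _ _ t-pos
      ; val< = <ᵇ⇒< _ _ t-val
      ; empty = λ c∈R k x-in y-in →
          T-not⁻ (All.lookup (All.all⁺ _ R t-empty) c∈R)
                 (any-allFin⁺ _ k (Equivalence.from T-∧ (x-in , y-in)))
      }
      where
      t-pos : T (pos i <ᵇ pos j)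
      t-rest : T ((val π i <ᵇ val π j) ∧ all (cellEmpty π i j) R)
      t-val : T (val π i <ᵇ val π j)
      t-empty : T (all (cellEmpty π i j) R)
      t-pos = proj₁ (Equivalence.to (T-∧ {pos i <ᵇ pos j}) t)
      t-rest = proj₂ (Equivalence.to (T-∧ {pos i <ᵇ pos j}) t)
      t-val = proj₁ (Equivalence.to (T-∧ {val π i <ᵇ val π j}) t-rest)
      t-empty = proj₂ (Equivalence.to (T-∧ {val π i <ᵇ val π j}) t-rest)

    Occurrence⇒isOcc : Occurrence R π i j → T (isOcc R π i j)
    Occurrence⇒isOcc o =
      Equivalence.from T-∧ (<⇒<ᵇ (pos< o) , Equivalence.from T-∧ (<⇒<ᵇ (val< o) , all-empty))
      where
      open Occurrence
      all-empty : T (all (cellEmpty π i j) R)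
      all-empty = All.all⁻ (cellEmpty π i j) (All.tabulate λ {(a , b)} c∈R → T-not⁺ λ t →
        let k , t-in = any-allFin⁻ _ t
        in uncurry (empty o c∈R k) (Equivalence.to (T-∧ {inGap (xBounds i j) a (pos k)}) t-in))

  isOcc-not-after : ∀ {n} R (π : Vec (Fin n) n) i j → ¬ pos i < pos j → ¬ T (isOcc R π i j)
  isOcc-not-after R π i j i≮j = i≮j ∘ Occurrence.pos< ∘ isOcc⇒Occurrence R π i j

  -- Equidistribution and the symmetries of the square

  record Equidistributed (R R′ : Mesh) : Set where
    constructor equidistributed
    field s≡ : ∀ n k → s R n k ≡ s R′ n k

  open Equidistributed public

  equi-sym : ∀ {R R′} → Equidistributed R R′ → Equidistributed R′ R
  equi-sym e = equidistributed λ n k → sym (s≡ e n k)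

  equi-trans : ∀ {R R′ R″} →
               Equidistributed R R′ → Equidistributed R′ R″ → Equidistributed R R″
  equi-trans e e′ = equidistributed λ n k → trans (s≡ e n k) (s≡ e′ n k)

  _⊆?_ : (R R′ : Mesh) → Dec (R ⊆ R′)
  _⊆?_ = DecSubset._⊆?_ (×-≡-dec _≟_ _≟_)

  equi-sameCells : ∀ R R′ → {True (R ⊆? R′)} → {True (R′ ⊆? R)} → Equidistributed R R′
  equi-sameCells R R′ {R⊆R′} {R′⊆R} = equidistributed λ n →
    s-involution R R′ n id id (λ _ → refl) λ {π} _ →
    occ-bijection R R′ {π} {π} id id (λ _ → refl) (λ _ → refl) λ i j →
      cong ((pos i <ᵇ pos j) ∧_) (cong ((val π i <ᵇ val π j) ∧_) (T-ext
        (all-anti-mono (cellEmpty π i j) (toWitness R′⊆R))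
        (all-anti-mono (cellEmpty π i j) (toWitness R⊆R′))))

  module _ {M : ℕ} where

    <ᵇ-reflect : ∀ y {z} → z ≤ M → (M ∸ z <ᵇ M ∸ y) ≡ (y <ᵇ z)
    <ᵇ-reflect y {z} z≤M = T-ext
      (λ t → <⇒<ᵇ (∸-cancelʳ-< {z} {y} {M} (<ᵇ⇒< (M ∸ z) (M ∸ y) t)))
      (λ t → <⇒<ᵇ (∸-monoʳ-< (<ᵇ⇒< y z t) z≤M))

    between-reflect : ∀ {x y z} → y ≤ M → z ≤ M →
                      between (M ∸ z) (M ∸ y) (M ∸ x) ≡ between x y z
    between-reflect {x} {y} {z} y≤M z≤M =
      trans (cong₂ _∧_ (<ᵇ-reflect y z≤M) (<ᵇ-reflect x y≤M)) (∧-comm (y <ᵇ z) (x <ᵇ y))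

    inGap-reflect : ∀ {p q x} → p ≤ M → q ≤ M → x ≤ M → ∀ a →
      inGap (0 ∷ M ∸ q ∷ M ∸ p ∷ M ∷ []) (opposite a) (M ∸ x) ≡ inGap (0 ∷ p ∷ q ∷ M ∷ []) a x
    inGap-reflect p≤M q≤M x≤M #0 = between-reflect x≤M p≤M
    inGap-reflect p≤M q≤M x≤M #1 = between-reflect x≤M q≤M
    inGap-reflect {q = q} {x} p≤M q≤M x≤M #2 =
      trans (cong (λ o → between o (M ∸ x) (M ∸ q)) (sym (n∸n≡0 M))) (between-reflect x≤M ≤-refl)

  opposite-injective : ∀ {n} {k k′ : Fin n} → opposite k ≡ opposite k′ → k ≡ k′
  opposite-injective {k = k} {k′} eq =
    trans (sym (opposite-involutive k)) (trans (cong opposite eq) (opposite-involutive k′))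

  reverseComplement : ∀ {n} → Vec (Fin n) n → Vec (Fin n) n
  reverseComplement π = tabulate (opposite ∘ lookup π ∘ opposite)

  reverseComplementCell : Cell → Cell
  reverseComplementCell (a , b) = opposite a , opposite b

  pos≤ : ∀ {n} (k : Fin n) → pos k ≤ suc n
  pos≤ k = m≤n⇒m≤1+n (toℕ<n k)

  val≤ : ∀ {n} (π : Vec (Fin n) n) k → val π k ≤ suc n
  val≤ π k = pos≤ (lookup π k)

  pos-opposite : ∀ {n} (k : Fin n) → pos (opposite k) ≡ suc n ∸ pos k
  pos-opposite k = trans (cong suc (opposite-prop k)) (sym (+-∸-assoc 1 (toℕ<n k)))

  module _ {n} (π : Vec (Fin n) n) where

    private
      rc : Vec (Fin n) n
      rc = reverseComplement π

    lookup-reverseComplement : ∀ k → lookup rc (opposite k) ≡ opposite (lookup π k)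
    lookup-reverseComplement k =
      trans (lookup∘tabulate _ (opposite k)) (cong (opposite ∘ lookup π) (opposite-involutive k))

    val-reverseComplement : ∀ k → val rc (opposite k) ≡ suc n ∸ val π k
    val-reverseComplement k = trans (cong pos (lookup-reverseComplement k)) (pos-opposite (lookup π k))

    reverseComplement-involutive : reverseComplement rc ≡ π
    reverseComplement-involutive = tabulate-≗lookup λ k →
      trans (cong opposite (lookup∘tabulate _ (opposite k)))
            (trans (opposite-involutive _) (cong (lookup π) (opposite-involutive k)))

    reverseComplement-perm : IsPermutation π → IsPermutation rc
    reverseComplement-perm perm = isPermutation λ {k} {k′} eq → opposite-injective (injective perm
      (opposite-injective (trans (sym (lookup∘tabulate _ k)) (trans eq (lookup∘tabulate _ k′)))))

    isOcc-reverseComplement : ∀ R i j →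
      isOcc R π i j ≡ isOcc (map reverseComplementCell R) rc (opposite j) (opposite i)
    isOcc-reverseComplement R i j = isOcc-transport R reverseComplementCell π i j rc (opposite j) (opposite i)
      opposite opposite opposite-involutive orders≡ cells≡
      where
      orders≡ : (pos i <ᵇ pos j) ∧ (val π i <ᵇ val π j)
              ≡ (pos (opposite j) <ᵇ pos (opposite i)) ∧ (val rc (opposite j) <ᵇ val rc (opposite i))
      orders≡ = sym (cong₂ _∧_
        (trans (cong₂ _<ᵇ_ (pos-opposite j) (pos-opposite i)) (<ᵇ-reflect (pos i) (pos≤ j)))
        (trans (cong₂ _<ᵇ_ (val-reverseComplement j) (val-reverseComplement i))
               (<ᵇ-reflect (val π i) (val≤ π j))))
      xBounds≡ : xBounds (opposite j) (opposite i) ≡ 0 ∷ suc n ∸ pos j ∷ suc n ∸ pos i ∷ suc n ∷ []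
      xBounds≡ = cong₂ (λ p q → 0 ∷ p ∷ q ∷ suc n ∷ []) (pos-opposite j) (pos-opposite i)
      yBounds≡ : yBounds rc (opposite j) (opposite i) ≡ 0 ∷ suc n ∸ val π j ∷ suc n ∸ val π i ∷ suc n ∷ []
      yBounds≡ = cong₂ (λ p q → 0 ∷ p ∷ q ∷ suc n ∷ []) (val-reverseComplement j) (val-reverseComplement i)
      cells≡ : ∀ c k →
        inCell rc (opposite j) (opposite i) (reverseComplementCell c) (opposite k) ≡ inCell π i j c k
      cells≡ (a , b) k = cong₂ _∧_
        (trans (cong₂ (λ bs x → inGap bs (opposite a) x) xBounds≡ (pos-opposite k))
               (inGap-reflect (pos≤ i) (pos≤ j) (pos≤ k) a))
        (trans (cong₂ (λ bs y → inGap bs (opposite b) y) yBounds≡ (val-reverseComplement k))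
               (inGap-reflect (val≤ π i) (val≤ π j) (val≤ π k) b))

  equi-reverseComplement : ∀ R → Equidistributed R (map reverseComplementCell R)
  equi-reverseComplement R = equidistributed λ n →
    s-involution R (map reverseComplementCell R) n reverseComplement
      (λ {π} → reverseComplement-perm π) (λ {π} _ → reverseComplement-involutive π) λ {π} _ →
    occ-bijection R (map reverseComplementCell R) {π} {reverseComplement π}
      (×.swap ∘ ×.map opposite opposite) (×.swap ∘ ×.map opposite opposite)
      (λ (i , j) → cong₂ _,_ (opposite-involutive i) (opposite-involutive j))
      (λ (i , j) → cong₂ _,_ (opposite-involutive i) (opposite-involutive j))
      (isOcc-reverseComplement π R)

  transposeCell : Cell → Cell
  transposeCell (a , b) = b , a

  module _ {n} {π : Vec (Fin n) n} (perm : IsPermutation π) where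

    private
      π⁻¹ : Vec (Fin n) n
      π⁻¹ = inverse π

    val-inverse : ∀ x → val π⁻¹ (lookup π x) ≡ pos x
    val-inverse x = cong pos (inverseˡ perm x)

    isOcc-inverse : ∀ R i j →
      isOcc R π i j ≡ isOcc (map transposeCell R) π⁻¹ (lookup π i) (lookup π j)
    isOcc-inverse R i j = isOcc-transport R transposeCell π i j π⁻¹ (lookup π i) (lookup π j)
      (lookup π) (lookup π⁻¹) (inverseʳ perm)
      (trans (∧-comm (pos i <ᵇ pos j) _)
             (cong ((val π i <ᵇ val π j) ∧_) (sym (cong₂ _<ᵇ_ (val-inverse i) (val-inverse j)))))
      cells≡
      where
      yBounds-inverse : yBounds π⁻¹ (lookup π i) (lookup π j) ≡ xBounds i j
      yBounds-inverse = cong₂ (λ p q → 0 ∷ p ∷ q ∷ suc n ∷ []) (val-inverse i) (val-inverse j)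
      cells≡ : ∀ c k →
        inCell π⁻¹ (lookup π i) (lookup π j) (transposeCell c) (lookup π k) ≡ inCell π i j c k
      cells≡ (a , b) k = trans
        (cong (inGap (yBounds π i j) b (val π k) ∧_)
              (cong₂ (λ bs x → inGap bs a x) yBounds-inverse (val-inverse k)))
        (∧-comm _ (inGap (xBounds i j) a (pos k)))

  equi-inverse : ∀ R → Equidistributed R (map transposeCell R)
  equi-inverse R = equidistributed λ n →
    s-involution R (map transposeCell R) n inverse inverse-perm inverse-involutive λ {π} perm →
    occ-bijection R (map transposeCell R) {π} {inverse π}
      (×.map (lookup π) (lookup π)) (×.map (lookup (inverse π)) (lookup (inverse π)))
      (λ (i , j) → cong₂ _,_ (inverseˡ perm i) (inverseˡ perm j))
      (λ (i , j) → cong₂ _,_ (inverseʳ perm i) (inverseʳ perm j))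
      (isOcc-inverse perm R)

  equi-transpose-rc : ∀ R → Equidistributed R (map reverseComplementCell (map transposeCell R))
  equi-transpose-rc R = equi-trans (equi-inverse R) (equi-reverseComplement (map transposeCell R))

  -- Patterns with shaded top row

  largest : ∀ {m} → Fin (suc m)
  largest {m} = fromℕ m

  toℕ-largest : ∀ {m} → toℕ (largest {m}) ≡ m
  toℕ-largest {m} = toℕ-fromℕ m

  ≢largest⇒< : ∀ {m} {v : Fin (suc m)} → v ≢ largest → toℕ v < m
  ≢largest⇒< {m} {v} v≢ =
    ≤∧≢⇒< (≤-pred (toℕ<n v)) (λ v≡m → v≢ (toℕ-injective (trans v≡m (sym toℕ-largest))))

  module _ {m} (π : Vec (Fin (suc m)) (suc m)) where

    val≡largest : ∀ k → lookup π k ≡ largest → val π k ≡ suc m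
    val≡largest k πk≡ = cong suc (trans (cong toℕ πk≡) toℕ-largest)

    val<largest : ∀ k → lookup π k ≢ largest → val π k < suc m
    val<largest k πk≢ = s≤s (≢largest⇒< πk≢)

  TopRowShaded : Mesh → Set
  TopRowShaded R = (#0 , #2) ∈ R × (#1 , #2) ∈ R × (#2 , #2) ∈ R

  occurrence-ends-at-largest : ∀ {m R} {π : Vec (Fin (suc m)) (suc m)} → TopRowShaded R →
    IsPermutation π → ∀ i j → T (isOcc R π i j) → lookup π j ≡ largest
  occurrence-ends-at-largest {m} {R} {π} (∈₀ , ∈₁ , ∈₂) perm i j t with lookup π j ≟ largest
  ... | yes πj≡ = πj≡
  ... | no  πj≢ = ⊥-elim (compare-i (<-cmp (toℕ p) (toℕ i)))
    where
    open Occurrence (isOcc⇒Occurrence R π i j t)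
    p : Fin (suc m)
    p = preimage π largest
    πp≡ : lookup π p ≡ largest
    πp≡ = lookup-preimage perm largest
    below-p : val π j < val π p
    below-p = subst (val π j <_) (sym (val≡largest π p πp≡)) (val<largest π j πj≢)
    above-j : T (inGap (yBounds π i j) #2 (val π p))
    above-j = between⁺ below-p (subst (_< suc (suc m)) (sym (val≡largest π p πp≡)) ≤-refl)
    compare-j : toℕ i < toℕ p → Tri (toℕ p < toℕ j) (toℕ p ≡ toℕ j) (toℕ j < toℕ p) → ⊥
    compare-j i<p (tri< p<j _ _) = empty ∈₁ p (between⁺ (s≤s i<p) (s≤s p<j)) above-j
    compare-j _   (tri≈ _ p≡j _) = πj≢ (trans (cong (lookup π) (sym (toℕ-injective p≡j))) πp≡)
    compare-j _   (tri> _ _ j<p) = empty ∈₂ p (between⁺ (s≤s j<p) (s≤s (toℕ<n p))) above-j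
    compare-i : Tri (toℕ p < toℕ i) (toℕ p ≡ toℕ i) (toℕ i < toℕ p) → ⊥
    compare-i (tri< p<i _ _) = empty ∈₀ p (between⁺ z<s (s≤s p<i)) above-j
    compare-i (tri≈ _ p≡i _) =
      <-asym val< (subst (λ x → val π j < val π x) (toℕ-injective p≡i) below-p)
    compare-i (tri> _ _ i<p) = compare-j i<p (<-cmp (toℕ p) (toℕ j))

  data ReversedBelow (P : ℕ) : ℕ → ℕ → Set where
    below : ∀ {t t′} → t < P → t′ + suc t ≡ P → ReversedBelow P t t′
    above : ∀ {t} → P ≤ t → ReversedBelow P t t

  <-cross : ∀ {a b c d} → a + b ≡ c + d → a < c → d < b
  <-cross {a} {b} {c} {d} eq a<c = ≰⇒> λ b≤d → <-irrefl eq (+-mono-<-≤ a<c b≤d)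

  +-suc-comm : ∀ a b → a + suc b ≡ b + suc a
  +-suc-comm a b = trans (+-suc a b) (trans (cong suc (+-comm a b)) (sym (+-suc b a)))

  ReversedBelow-< : ∀ {P t t′} → t < P → ReversedBelow P t t′ → t′ < P
  ReversedBelow-< _   (below _ eq) = subst (_ <_) eq (m<m+n _ z<s)
  ReversedBelow-< t<P (above P≤t)  = ⊥-elim (<⇒≱ t<P P≤t)

  ReversedBelow-sym : ∀ {P t t′} → ReversedBelow P t t′ → ReversedBelow P t′ t
  ReversedBelow-sym {t = t} {t′} r@(below t<P eq) =
    below (ReversedBelow-< t<P r) (trans (+-suc-comm t t′) eq)
  ReversedBelow-sym (above P≤t) = above P≤t

  ReversedBelow-functional : ∀ {P t u v} → ReversedBelow P t u → ReversedBelow P t v → u ≡ v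
  ReversedBelow-functional {t = t} (below _ equ) (below _ eqv) =
    +-cancelʳ-≡ (suc t) _ _ (trans equ (sym eqv))
  ReversedBelow-functional (below t<P _) (above P≤t) = ⊥-elim (<⇒≱ t<P P≤t)
  ReversedBelow-functional (above P≤t) (below t<P _) = ⊥-elim (<⇒≱ t<P P≤t)
  ReversedBelow-functional (above _)   (above _)     = refl

  ReversedBelow-sum : ∀ {P s s′} → s < P → ReversedBelow P s s′ → s′ + suc s ≡ P
  ReversedBelow-sum _   (below _ eq) = eq
  ReversedBelow-sum s<P (above P≤s)  = ⊥-elim (<⇒≱ s<P P≤s)

  reverseBelow : ∀ {N} → Fin N → Fin N → Fin N
  reverseBelow p x with toℕ x <? toℕ p
  ... | yes _ = fromℕ< (≤-<-trans (m∸n≤m (toℕ p) (suc (toℕ x))) (toℕ<n p))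
  ... | no  _ = x

  reverseBelow-reversed : ∀ {N} (p x : Fin N) → ReversedBelow (toℕ p) (toℕ x) (toℕ (reverseBelow p x))
  reverseBelow-reversed p x with toℕ x <? toℕ p
  ... | yes x<p = below x<p (trans (cong (_+ suc (toℕ x)) (toℕ-fromℕ< _)) (m∸n+n≡m x<p))
  ... | no  x≮p = above (≮⇒≥ x≮p)

  reverseBelow-involutive : ∀ {N} (p x : Fin N) → reverseBelow p (reverseBelow p x) ≡ x
  reverseBelow-involutive p x = toℕ-injective (ReversedBelow-functional
    (reverseBelow-reversed p (reverseBelow p x)) (ReversedBelow-sym (reverseBelow-reversed p x)))

  reverseBelow-above : ∀ {N} (p x : Fin N) → ¬ toℕ x < toℕ p → reverseBelow p x ≡ x
  reverseBelow-above p x x≮p with toℕ x <? toℕ p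
  ... | yes x<p = ⊥-elim (x≮p x<p)
  ... | no  _   = refl

  reverseBelow-fixes : ∀ {N} (p : Fin N) → reverseBelow p p ≡ p
  reverseBelow-fixes p = reverseBelow-above p p (<-irrefl refl)

  reverseBelow-below : ∀ {N} (p x : Fin N) → toℕ x < toℕ p → toℕ (reverseBelow p x) < toℕ p
  reverseBelow-below p x x<p = ReversedBelow-< x<p (reverseBelow-reversed p x)

  reverseBelow≡⇒≡ : ∀ {N} {p x : Fin N} → reverseBelow p x ≡ p → x ≡ p
  reverseBelow≡⇒≡ {p = p} {x} eq =
    trans (sym (reverseBelow-involutive p x)) (trans (cong (reverseBelow p) eq) (reverseBelow-fixes p))

  swap01 : Fin 3 → Fin 3
  swap01 #0 = #1
  swap01 #1 = #0
  swap01 #2 = #2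

  inGap-reverseBelow : ∀ {P N s s′ t t′} → s < P → ReversedBelow P s s′ → ReversedBelow P t t′ → ∀ a →
    inGap (0 ∷ suc s′ ∷ suc P ∷ N ∷ []) (swap01 a) (suc t′)
      ≡ inGap (0 ∷ suc s ∷ suc P ∷ N ∷ []) a (suc t)
  inGap-reverseBelow {P} {N} {s} {s′} {t} {t′} s<P rs (below t<P eqt) a = gap a
    where
    eqs : s′ + suc s ≡ P
    eqs = ReversedBelow-sum s<P rs
    t′<P : t′ < P
    t′<P = ReversedBelow-< t<P (below t<P eqt)
    cross : s′ + suc s ≡ t′ + suc t
    cross = trans eqs (sym eqt)
    cross′ : suc t + t′ ≡ suc s + s′
    cross′ = trans (+-comm (suc t) t′) (trans (sym cross) (+-comm s′ (suc s)))
    gap : ∀ a → inGap (0 ∷ suc s′ ∷ suc P ∷ N ∷ []) (swap01 a) (suc t′)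
              ≡ inGap (0 ∷ suc s ∷ suc P ∷ N ∷ []) a (suc t)
    gap #0 = T-ext
      (λ h → between⁺ z<s (<-cross cross (s<s⁻¹ (proj₁ (between⁻ (suc s′) (suc t′) (suc P) h)))))
      (λ h → between⁺ (s<s (<-cross cross′ (proj₂ (between⁻ 0 (suc t) (suc s) h)))) (s<s t′<P))
    gap #1 = T-ext
      (λ h → between⁺ (<-cross (sym cross) (s<s⁻¹ (proj₂ (between⁻ 0 (suc t′) (suc s′) h)))) (s<s t<P))
      (λ h → between⁺ z<s (s<s (<-cross (sym cross′) (proj₁ (between⁻ (suc s) (suc t) (suc P) h)))))
    gap #2 = ¬T⇒≡
      (λ h → <-asym t′<P (s<s⁻¹ (proj₁ (between⁻ (suc P) (suc t′) N h))))
      (λ h → <-asym t<P (s<s⁻¹ (proj₁ (between⁻ (suc P) (suc t) N h))))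
  inGap-reverseBelow {P} {N} {s} {s′} {t} s<P rs (above P≤t) a = gap a
    where
    s′<P : s′ < P
    s′<P = ReversedBelow-< s<P rs
    gap : ∀ a → inGap (0 ∷ suc s′ ∷ suc P ∷ N ∷ []) (swap01 a) (suc t)
              ≡ inGap (0 ∷ suc s ∷ suc P ∷ N ∷ []) a (suc t)
    gap #0 = ¬T⇒≡
      (λ h → <⇒≱ (s<s⁻¹ (proj₂ (between⁻ (suc s′) (suc t) (suc P) h))) P≤t)
      (λ h → <⇒≱ (<-trans (s<s⁻¹ (proj₂ (between⁻ 0 (suc t) (suc s) h))) s<P) P≤t)
    gap #1 = ¬T⇒≡
      (λ h → <⇒≱ (<-trans (s<s⁻¹ (proj₂ (between⁻ 0 (suc t) (suc s′) h))) s′<P) P≤t)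
      (λ h → <⇒≱ (s<s⁻¹ (proj₂ (between⁻ (suc s) (suc t) (suc P) h))) P≤t)
    gap #2 = refl

  swapLowerRows : Cell → Cell
  swapLowerRows (a , b) = a , swap01 b

  swapLeftColumns : Cell → Cell
  swapLeftColumns (a , b) = swap01 a , b

  TopRowShaded-swapLowerRows : ∀ {R} → TopRowShaded R → TopRowShaded (map swapLowerRows R)
  TopRowShaded-swapLowerRows (∈₀ , ∈₁ , ∈₂) =
    ∈-map⁺ swapLowerRows ∈₀ , ∈-map⁺ swapLowerRows ∈₁ , ∈-map⁺ swapLowerRows ∈₂

  TopRowShaded-swapLeftColumns : ∀ {R} → TopRowShaded R → TopRowShaded (map swapLeftColumns R)
  TopRowShaded-swapLeftColumns (∈₀ , ∈₁ , ∈₂) =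
    ∈-map⁺ swapLeftColumns ∈₁ , ∈-map⁺ swapLeftColumns ∈₀ , ∈-map⁺ swapLeftColumns ∈₂

  complementBelowMax : ∀ {m} → Vec (Fin (suc m)) (suc m) → Vec (Fin (suc m)) (suc m)
  complementBelowMax π = tabulate (reverseBelow largest ∘ lookup π)

  module _ {m} (π : Vec (Fin (suc m)) (suc m)) where

    private
      ψ : Vec (Fin (suc m)) (suc m)
      ψ = complementBelowMax π
      ρ : Fin (suc m) → Fin (suc m)
      ρ = reverseBelow largest

    lookup-complementBelowMax : ∀ k → lookup ψ k ≡ reverseBelow largest (lookup π k)
    lookup-complementBelowMax = lookup∘tabulate _

    complementBelowMax-involutive : complementBelowMax ψ ≡ π
    complementBelowMax-involutive = tabulate-≗lookup λ k →
      trans (cong (reverseBelow largest) (lookup-complementBelowMax k)) (reverseBelow-involutive largest _)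

    complementBelowMax-perm : IsPermutation π → IsPermutation ψ
    complementBelowMax-perm perm = isPermutation λ {k} {k′} eq → injective perm (begin
      lookup π k           ≡⟨ reverseBelow-involutive largest _ ⟨
      ρ (ρ (lookup π k))   ≡⟨ cong ρ (trans (sym (lookup-complementBelowMax k))
                                            (trans eq (lookup-complementBelowMax k′))) ⟩
      ρ (ρ (lookup π k′))  ≡⟨ reverseBelow-involutive largest _ ⟩
      lookup π k′          ∎)

    complementBelowMax-largest⁺ : ∀ k → lookup π k ≡ largest → lookup ψ k ≡ largest
    complementBelowMax-largest⁺ k eq =
      trans (lookup-complementBelowMax k) (trans (cong (reverseBelow largest) eq) (reverseBelow-fixes largest))

    complementBelowMax-largest⁻ : ∀ k → lookup ψ k ≡ largest → lookup π k ≡ largest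
    complementBelowMax-largest⁻ k eq = reverseBelow≡⇒≡ (trans (sym (lookup-complementBelowMax k)) eq)

    below-largest : ∀ k → ReversedBelow m (toℕ (lookup π k)) (toℕ (lookup ψ k))
    below-largest k = subst₂ (λ P t′ → ReversedBelow P (toℕ (lookup π k)) t′) toℕ-largest
      (cong toℕ (sym (lookup-complementBelowMax k))) (reverseBelow-reversed largest (lookup π k))

    isOcc-complementBelowMax : ∀ {R} → TopRowShaded R → IsPermutation π → ∀ i j →
      isOcc R π i j ≡ isOcc (map swapLowerRows R) ψ i j
    isOcc-complementBelowMax {R} top perm i j with lookup π j ≟ largest
    ... | no πj≢ = ¬T⇒≡ (πj≢ ∘ occurrence-ends-at-largest top perm i j)
      (πj≢ ∘ complementBelowMax-largest⁻ j ∘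
        occurrence-ends-at-largest (TopRowShaded-swapLowerRows top) (complementBelowMax-perm perm) i j)
    ... | yes πj≡ with lookup π i ≟ largest
    ...   | yes πi≡ =
      ¬T⇒≡ (isOcc-not-after R π i j i≮j) (isOcc-not-after (map swapLowerRows R) ψ i j i≮j)
      where
      i≮j : ¬ pos i < pos j
      i≮j = <-irrefl (cong pos (injective perm (trans πi≡ (sym πj≡))))
    ...   | no πi≢ = isOcc-transport R swapLowerRows π i j ψ i j id id (λ _ → refl)
      (cong ((pos i <ᵇ pos j) ∧_) (trans (T⇒≡true (<⇒<ᵇ (vals< π πi≢ πj≡)))
                                         (sym (T⇒≡true (<⇒<ᵇ (vals< ψ ψi≢ ψj≡))))))
      λ (a , b) k → cong (inGap (xBounds i j) a (pos k) ∧_) (begin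
        inGap (yBounds ψ i j) (swap01 b) (val ψ k)
          ≡⟨ cong (λ y → inGap (0 ∷ val ψ i ∷ y ∷ suc (suc m) ∷ []) (swap01 b) (val ψ k))
                  (val≡largest ψ j ψj≡) ⟩
        inGap (0 ∷ val ψ i ∷ suc m ∷ suc (suc m) ∷ []) (swap01 b) (val ψ k)
          ≡⟨ inGap-reverseBelow (≢largest⇒< πi≢) (below-largest i) (below-largest k) b ⟩
        inGap (0 ∷ val π i ∷ suc m ∷ suc (suc m) ∷ []) b (val π k)
          ≡⟨ cong (λ y → inGap (0 ∷ val π i ∷ y ∷ suc (suc m) ∷ []) b (val π k)) (val≡largest π j πj≡) ⟨
        inGap (yBounds π i j) b (val π k) ∎)
      where
      ψi≢ : lookup ψ i ≢ largest
      ψi≢ = πi≢ ∘ complementBelowMax-largest⁻ i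
      ψj≡ : lookup ψ j ≡ largest
      ψj≡ = complementBelowMax-largest⁺ j πj≡
      vals< : (σ : Vec (Fin (suc m)) (suc m)) → lookup σ i ≢ largest → lookup σ j ≡ largest → val σ i < val σ j
      vals< σ σi≢ σj≡ = subst (val σ i <_) (sym (val≡largest σ j σj≡)) (val<largest σ i σi≢)

  equi-swapLowerRows : ∀ R → TopRowShaded R → Equidistributed R (map swapLowerRows R)
  equi-swapLowerRows R top = equidistributed s-equal
    where
    s-equal : ∀ n k → s R n k ≡ s (map swapLowerRows R) n k
    s-equal zero    k = refl
    s-equal (suc m) = s-involution R (map swapLowerRows R) (suc m) complementBelowMax
      (λ {π} → complementBelowMax-perm π) (λ {π} _ → complementBelowMax-involutive π) λ {π} perm →
      occ-bijection R (map swapLowerRows R) {π} {complementBelowMax π} id id (λ _ → refl) (λ _ → refl)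
        (isOcc-complementBelowMax π top perm)

  positionOfMax : ∀ {m} → Vec (Fin (suc m)) (suc m) → Fin (suc m)
  positionOfMax π = preimage π largest

  reverseBeforeMax : ∀ {m} → Vec (Fin (suc m)) (suc m) → Vec (Fin (suc m)) (suc m)
  reverseBeforeMax π = tabulate (lookup π ∘ reverseBelow (positionOfMax π))

  module _ {m} {π : Vec (Fin (suc m)) (suc m)} (perm : IsPermutation π) where

    private
      p : Fin (suc m)
      p = positionOfMax π
      ρ : Fin (suc m) → Fin (suc m)
      ρ = reverseBelow p
      φ : Vec (Fin (suc m)) (suc m)
      φ = reverseBeforeMax π

    lookup-reverseBeforeMax : ∀ k → lookup φ k ≡ lookup π (ρ k)
    lookup-reverseBeforeMax = lookup∘tabulate _

    lookup-positionOfMax : lookup π p ≡ largest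
    lookup-positionOfMax = lookup-preimage perm largest

    reverseBeforeMax-perm : IsPermutation φ
    reverseBeforeMax-perm = isPermutation λ {k} {k′} eq → begin
      k       ≡⟨ reverseBelow-involutive p k ⟨
      ρ (ρ k)  ≡⟨ cong ρ (injective perm (trans (sym (lookup-reverseBeforeMax k))
                                               (trans eq (lookup-reverseBeforeMax k′)))) ⟩
      ρ (ρ k′) ≡⟨ reverseBelow-involutive p k′ ⟩
      k′      ∎

    reverseBeforeMax-largest : lookup φ p ≡ largest
    reverseBeforeMax-largest =
      trans (lookup-reverseBeforeMax p) (trans (cong (lookup π) (reverseBelow-fixes p)) lookup-positionOfMax)

    positionOfMax-reverseBeforeMax : positionOfMax φ ≡ p
    positionOfMax-reverseBeforeMax =
      injective reverseBeforeMax-perm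
        (trans (lookup-preimage reverseBeforeMax-perm largest) (sym reverseBeforeMax-largest))

    reverseBeforeMax-involutive : reverseBeforeMax φ ≡ π
    reverseBeforeMax-involutive = tabulate-≗lookup λ k → begin
      lookup φ (reverseBelow (positionOfMax φ) k)
        ≡⟨ cong (λ q → lookup φ (reverseBelow q k)) positionOfMax-reverseBeforeMax ⟩
      lookup φ (ρ k)                              ≡⟨ lookup-reverseBeforeMax (ρ k) ⟩
      lookup π (ρ (ρ k))                          ≡⟨ cong (lookup π) (reverseBelow-involutive p k) ⟩
      lookup π k                                  ∎

    at-positionOfMax : ∀ {j} → lookup π j ≡ largest → j ≡ p
    at-positionOfMax πj≡ = injective perm (trans πj≡ (sym lookup-positionOfMax))

    val-reverseBeforeMax : ∀ k → val φ (ρ k) ≡ val π k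
    val-reverseBeforeMax k =
      cong pos (trans (lookup-reverseBeforeMax (ρ k)) (cong (lookup π) (reverseBelow-involutive p k)))

    isOcc-reverseBeforeMax-at-max : ∀ R i → isOcc R π i p ≡ isOcc (map swapLeftColumns R) φ (ρ i) p
    isOcc-reverseBeforeMax-at-max R i = by-cases (toℕ i <? toℕ p)
      where
      by-cases : Dec (toℕ i < toℕ p) → isOcc R π i p ≡ isOcc (map swapLeftColumns R) φ (ρ i) p
      by-cases (no i≮p) = ¬T⇒≡ (isOcc-not-after R π i p (i≮p ∘ s<s⁻¹))
        (isOcc-not-after (map swapLeftColumns R) φ (ρ i) p
          (i≮p ∘ subst (λ x → toℕ x < toℕ p) (reverseBelow-above p i i≮p) ∘ s<s⁻¹))
      by-cases (yes i<p) = isOcc-transport R swapLeftColumns π i p φ (ρ i) p ρ ρ (reverseBelow-involutive p)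
        (cong₂ _∧_ (trans (T⇒≡true (<⇒<ᵇ (s<s i<p))) (sym (T⇒≡true (<⇒<ᵇ (s<s (reverseBelow-below p i i<p))))))
                   (sym (cong₂ _<ᵇ_ (val-reverseBeforeMax i) val-p)))
        λ (a , b) k → cong₂ _∧_
          (inGap-reverseBelow i<p (reverseBelow-reversed p i) (reverseBelow-reversed p k) a)
          (cong₂ (λ bs y → inGap bs b y)
                 (cong₂ (λ u v → 0 ∷ u ∷ v ∷ suc (suc m) ∷ []) (val-reverseBeforeMax i) val-p)
                 (val-reverseBeforeMax k))
        where
        val-p : val φ p ≡ val π p
        val-p = trans (cong (val φ) (sym (reverseBelow-fixes p))) (val-reverseBeforeMax p)

    isOcc-reverseBeforeMax : ∀ {R} → TopRowShaded R → ∀ i j →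
      isOcc R π i j ≡ isOcc (map swapLeftColumns R) φ (ρ i) j
    isOcc-reverseBeforeMax {R} top i j with lookup π j ≟ largest
    ... | yes πj≡ = subst (λ q → isOcc R π i q ≡ isOcc (map swapLeftColumns R) φ (ρ i) q)
                          (sym (at-positionOfMax πj≡)) (isOcc-reverseBeforeMax-at-max R i)
    ... | no  πj≢ = ¬T⇒≡ (πj≢ ∘ occurrence-ends-at-largest top perm i j)
      (πj≢ ∘ φj≡⇒πj≡ ∘ occurrence-ends-at-largest (TopRowShaded-swapLeftColumns top) reverseBeforeMax-perm (ρ i) j)
      where
      φj≡⇒πj≡ : lookup φ j ≡ largest → lookup π j ≡ largest
      φj≡⇒πj≡ φj≡ = trans
        (cong (lookup π) (injective reverseBeforeMax-perm (trans φj≡ (sym reverseBeforeMax-largest))))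
        lookup-positionOfMax

  equi-swapLeftColumns : ∀ R → TopRowShaded R → Equidistributed R (map swapLeftColumns R)
  equi-swapLeftColumns R top = equidistributed s-equal
    where
    s-equal : ∀ n k → s R n k ≡ s (map swapLeftColumns R) n k
    s-equal zero    k = refl
    s-equal (suc m) = s-involution R (map swapLeftColumns R) (suc m) reverseBeforeMax
      reverseBeforeMax-perm reverseBeforeMax-involutive λ {π} perm →
      occ-bijection R (map swapLeftColumns R) {π} {reverseBeforeMax π}
          (×.map₁ (reverseBelow (positionOfMax π))) (×.map₁ (reverseBelow (positionOfMax π)))
        (λ (i , j) → cong (_, j) (reverseBelow-involutive (positionOfMax π) i))
        (λ (i , j) → cong (_, j) (reverseBelow-involutive (positionOfMax π) i))
        (isOcc-reverseBeforeMax perm top)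

  -- Numbered by their position in patterns.
  R₁ R₅ R₉ R₁₃ : Mesh
  R₁  = (#0 , #2) ∷ (#1 , #2) ∷ (#2 , #2) ∷ (#2 , #1) ∷ (#0 , #0) ∷ []
  R₅  = (#0 , #2) ∷ (#1 , #2) ∷ (#2 , #2) ∷ (#2 , #1) ∷ (#1 , #0) ∷ []
  R₉  = (#0 , #2) ∷ (#1 , #2) ∷ (#2 , #2) ∷ (#0 , #1) ∷ (#2 , #0) ∷ []
  R₁₃ = (#0 , #2) ∷ (#1 , #2) ∷ (#2 , #2) ∷ (#1 , #1) ∷ (#2 , #0) ∷ []

  top-shaded : ∀ {c₁ c₂} → TopRowShaded ((#0 , #2) ∷ (#1 , #2) ∷ (#2 , #2) ∷ c₁ ∷ c₂ ∷ [])
  top-shaded = here refl , there (here refl) , there (there (here refl))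

  Transfer : (Mesh → Mesh) → Set
  Transfer f = ∀ {B R} → Equidistributed B R₅ → {True (f B ⊆? R)} → {True (R ⊆? f B)} → Equidistributed R R₅

  transfer : (f : Mesh → Mesh) → (∀ R → Equidistributed R (f R)) → Transfer f
  transfer f equi-f {B} {R} B∼ {p} {q} =
    equi-trans (equi-sym (equi-trans (equi-f B) (equi-sameCells (f B) R {p} {q}))) B∼

  R₅∼R₅ : Equidistributed R₅ R₅
  R₅∼R₅ = equidistributed λ _ _ → refl

  R₁∼R₅ : Equidistributed R₁ R₅
  R₁∼R₅ = equi-trans (equi-swapLeftColumns R₁ top-shaded) (equi-sameCells _ R₅)

  R₉∼R₅ : Equidistributed R₉ R₅
  R₉∼R₅ = equi-trans (equi-sym (equi-trans (equi-swapLowerRows R₁ top-shaded) (equi-sameCells _ R₉))) R₁∼R₅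

  R₁₃∼R₅ : Equidistributed R₁₃ R₅
  R₁₃∼R₅ = equi-trans (equi-sym (equi-trans (equi-swapLeftColumns R₉ top-shaded) (equi-sameCells _ R₁₃))) R₉∼R₅

  patterns∼R₅ : All (λ R → Equidistributed R R₅) patterns
  patterns∼R₅ =
      R₁∼R₅  ∷ by-transpose-rc R₁∼R₅  ∷ by-transpose R₁∼R₅  ∷ by-rc R₁∼R₅
    ∷ R₅∼R₅  ∷ by-transpose-rc R₅∼R₅  ∷ by-transpose R₅∼R₅  ∷ by-rc R₅∼R₅
    ∷ R₉∼R₅  ∷ by-transpose-rc R₉∼R₅  ∷ by-transpose R₉∼R₅  ∷ by-rc R₉∼R₅
    ∷ R₁₃∼R₅ ∷ by-transpose R₁₃∼R₅ ∷ by-transpose-rc R₁₃∼R₅ ∷ by-rc R₁₃∼R₅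
    ∷ []
    where
    by-transpose-rc : Transfer (map reverseComplementCell ∘ map transposeCell)
    by-transpose-rc = transfer (map reverseComplementCell ∘ map transposeCell) equi-transpose-rc
    by-transpose : Transfer (map transposeCell)
    by-transpose = transfer (map transposeCell) equi-inverse
    by-rc : Transfer (map reverseComplementCell)
    by-rc = transfer (map reverseComplementCell) equi-reverseComplement

  -- Permutations avoiding R₅

  record Witness₅ {n} (π : Vec (Fin (suc n)) (suc n)) : Set where
    constructor witness
    field
      q : Fin n
      max-after-q : lookup π (suc q) ≡ largest
      tail-below-q : ∀ k → suc (toℕ q) < toℕ k → toℕ (lookup π k) < toℕ (lookup π (inject₁ q))

  avoids₅ : ∀ {n} → Vec (Fin n) n → Bool
  avoids₅ π = ⌊ occ R₅ π ℕ.≟ 0 ⌋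

  module _ {n} {π : Vec (Fin (suc n)) (suc n)} (perm : IsPermutation π) where

    witness⇒isOcc : (w : Witness₅ π) → T (isOcc R₅ π (inject₁ (Witness₅.q w)) (suc (Witness₅.q w)))
    witness⇒isOcc (witness q πj≡ tail<) = Occurrence⇒isOcc R₅ π i j (record
      { pos< = s<s i<j
      ; val< = subst (val π i <_) (sym (val≡largest π j πj≡)) (val<largest π i πi≢)
      ; empty = empty
      })
      where
      i j : Fin (suc n)
      i = inject₁ q
      j = suc q
      i<j : toℕ i < toℕ j
      i<j = s<s (≤-reflexive (toℕ-inject₁ q))
      πi≢ : lookup π i ≢ largest
      πi≢ πi≡ = <-irrefl (cong toℕ (injective perm (trans πi≡ (sym πj≡)))) i<j
      above-max : ∀ k → ¬ val π j < val π k
      above-max k vj<vk = <⇒≱ (subst (_< val π k) (val≡largest π j πj≡) vj<vk) (toℕ<n (lookup π k))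
      above-j : ∀ k → ¬ T (inGap (yBounds π i j) #2 (val π k))
      above-j k = above-max k ∘ proj₁ ∘ between⁻ (val π j) (val π k) (suc (suc n))
      empty : ∀ {a b} → (a , b) ∈ R₅ → ∀ k →
              T (inGap (xBounds i j) a (pos k)) → ¬ T (inGap (yBounds π i j) b (val π k))
      empty (here refl)                                 k _ = above-j k
      empty (there (here refl))                         k _ = above-j k
      empty (there (there (here refl)))                 k _ = above-j k
      empty (there (there (there (here refl))))         k x-in y-in =
        <-asym (tail< k (s<s⁻¹ (proj₁ (between⁻ (pos j) (pos k) (suc (suc n)) x-in))))
               (s<s⁻¹ (proj₁ (between⁻ (val π i) (val π k) (val π j) y-in)))
      empty (there (there (there (there (here refl))))) k x-in _ =
        let i<k , k<j = between⁻ (pos i) (pos k) (pos j) x-in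
        in <⇒≱ (s<s⁻¹ i<k) (subst (toℕ k ≤_) (sym (toℕ-inject₁ q)) (s≤s⁻¹ (s<s⁻¹ k<j)))

    -- Cell (2,1) puts every entry after j below π(i); cell (1,0) puts π(q) above π(i) when i < q.
    isOcc⇒witness : ∀ i j → T (isOcc R₅ π i j) → Witness₅ π
    isOcc⇒witness i zero    t = ⊥-elim (isOcc-not-after R₅ π i zero (λ { (s≤s ()) }) t)
    isOcc⇒witness i (suc q) t = witness q πj≡ tail<
      where
      j : Fin (suc n)
      j = suc q
      open Occurrence (isOcc⇒Occurrence R₅ π i j t)
      πj≡ : lookup π j ≡ largest
      πj≡ = occurrence-ends-at-largest {R = R₅} top-shaded perm i j t
      i≤q : toℕ i ≤ toℕ q
      i≤q = s≤s⁻¹ (s<s⁻¹ pos<)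
      tail<ᵢ : ∀ k → suc (toℕ q) < toℕ k → toℕ (lookup π k) < toℕ (lookup π i)
      tail<ᵢ k j<k with val π i <? val π k
      ... | yes vi<vk = ⊥-elim (empty (there (there (there (here refl)))) k
                                     (between⁺ (s<s j<k) (s<s (toℕ<n k))) (between⁺ vi<vk vk<vj))
        where
        πk≢ : lookup π k ≢ largest
        πk≢ πk≡ = <-irrefl (cong toℕ (injective perm (trans πj≡ (sym πk≡)))) j<k
        vk<vj : val π k < val π j
        vk<vj = subst (val π k <_) (sym (val≡largest π j πj≡)) (val<largest π k πk≢)
      ... | no vi≮vk = ≤∧≢⇒< (s≤s⁻¹ (≮⇒≥ vi≮vk)) λ πk≡πi →
        <-irrefl (sym (cong toℕ (injective perm (toℕ-injective πk≡πi)))) (<-≤-trans (s≤s i≤q) (<⇒≤ j<k))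
      tail< : ∀ k → suc (toℕ q) < toℕ k → toℕ (lookup π k) < toℕ (lookup π (inject₁ q))
      tail< k j<k with toℕ i ℕ.≟ toℕ q
      ... | yes i≡q = subst (λ x → toℕ (lookup π k) < toℕ (lookup π x))
                            (toℕ-injective (trans i≡q (sym (toℕ-inject₁ q)))) (tail<ᵢ k j<k)
      ... | no  i≢q with val π (inject₁ q) <? val π i
      ...   | yes vq<vi = ⊥-elim (empty (there (there (there (there (here refl))))) (inject₁ q)
                            (between⁺ (s<s (subst (toℕ i <_) (sym (toℕ-inject₁ q)) (≤∧≢⇒< i≤q i≢q)))
                                      (s<s (s≤s (≤-reflexive (toℕ-inject₁ q)))))
                            (between⁺ z<s vq<vi))
      ...   | no  vq≮vi = <-≤-trans (tail<ᵢ k j<k) (s≤s⁻¹ (≮⇒≥ vq≮vi))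

    witness⇒occ≢0 : Witness₅ π → occ R₅ π ≢ 0
    witness⇒occ≢0 w occ≡0 =
      occ≡0⇒¬isOcc R₅ π occ≡0 (inject₁ (Witness₅.q w)) (suc (Witness₅.q w)) (witness⇒isOcc w)

    occ≢0⇒witness : occ R₅ π ≢ 0 → Witness₅ π
    occ≢0⇒witness occ≢0 = let (i , j) , t = occ≢0⇒isOcc R₅ π occ≢0 in isOcc⇒witness i j t

    witness? : Dec (Witness₅ π)
    witness? = map′ occ≢0⇒witness witness⇒occ≢0 (¬? (occ R₅ π ℕ.≟ 0))

    avoids₅-witness : Witness₅ π → avoids₅ π ≡ false
    avoids₅-witness w with occ R₅ π ℕ.≟ 0
    ... | yes occ≡0 = ⊥-elim (witness⇒occ≢0 w occ≡0)
    ... | no  _     = refl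

    avoids₅-¬witness : ¬ Witness₅ π → avoids₅ π ≡ true
    avoids₅-¬witness ¬w with occ R₅ π ℕ.≟ 0
    ... | yes _     = refl
    ... | no  occ≢0 = ⊥-elim (¬w (occ≢0⇒witness occ≢0))

  prepend : ∀ {n} → Fin (suc n) → Vec (Fin n) n → Vec (Fin (suc n)) (suc n)
  prepend v σ = v ∷ Vec.map (punchIn v) σ

  lookup-prepend : ∀ {n} (v : Fin (suc n)) σ k → lookup (prepend v σ) (suc k) ≡ punchIn v (lookup σ k)
  lookup-prepend v σ k = lookup-map k (punchIn v) σ

  prepend-perm : ∀ {n} (v : Fin (suc n)) {σ : Vec (Fin n) n} → IsPermutation σ → IsPermutation (prepend v σ)
  prepend-perm v {σ} perm = isPermutation injective′
    where
    injective′ : Injective _≡_ _≡_ (lookup (prepend v σ))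
    injective′ {zero}  {zero}  _  = refl
    injective′ {zero}  {suc k} eq = ⊥-elim (punchInᵢ≢i v (lookup σ k) (sym (trans eq (lookup-prepend v σ k))))
    injective′ {suc k} {zero}  eq = ⊥-elim (punchInᵢ≢i v (lookup σ k) (trans (sym (lookup-prepend v σ k)) eq))
    injective′ {suc k} {suc k′} eq = cong suc (injective perm (punchIn-injective v _ _
      (trans (sym (lookup-prepend v σ k)) (trans eq (lookup-prepend v σ k′)))))

  -- A left inverse of punchIn v; its value at v itself is arbitrary.
  unpunch : ∀ {n} → Fin (suc (suc n)) → Fin (suc (suc n)) → Fin (suc n)
  unpunch zero    zero    = zero
  unpunch zero    (suc x) = x
  unpunch (suc v) zero    = zero
  unpunch {zero}  (suc v) (suc x) = zero
  unpunch {suc n} (suc v) (suc x) = suc (unpunch v x)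

  unpunch-punchIn : ∀ {n} (v : Fin (suc (suc n))) x → unpunch v (punchIn v x) ≡ x
  unpunch-punchIn zero    x       = refl
  unpunch-punchIn (suc v) zero    = refl
  unpunch-punchIn {suc n} (suc v) (suc x) = cong suc (unpunch-punchIn v x)

  punchIn-unpunch : ∀ {n} (v x : Fin (suc (suc n))) → v ≢ x → punchIn v (unpunch v x) ≡ x
  punchIn-unpunch zero    zero    v≢x = ⊥-elim (v≢x refl)
  punchIn-unpunch zero    (suc x) _   = refl
  punchIn-unpunch (suc v) zero    _   = refl
  punchIn-unpunch {zero}  (suc zero) (suc zero) v≢x = ⊥-elim (v≢x refl)
  punchIn-unpunch {suc n} (suc v) (suc x) v≢x = cong suc (punchIn-unpunch v x (v≢x ∘ cong suc))

  unprepend : ∀ {n} → Vec (Fin (suc (suc n))) (suc (suc n)) → Fin (suc (suc n)) × Vec (Fin (suc n)) (suc n)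
  unprepend (v ∷ τ) = v , Vec.map (unpunch v) τ

  unprepend-prepend : ∀ {n} (v : Fin (suc (suc n))) σ → unprepend (prepend v σ) ≡ (v , σ)
  unprepend-prepend v σ = cong (v ,_) (begin
    Vec.map (unpunch v) (Vec.map (punchIn v) σ) ≡⟨ Vec.map-∘ (unpunch v) (punchIn v) σ ⟨
    Vec.map (unpunch v ∘ punchIn v) σ          ≡⟨ Vec.map-cong (unpunch-punchIn v) σ ⟩
    Vec.map id σ                               ≡⟨ Vec.map-id σ ⟩
    σ                                          ∎)

  map-fixes : ∀ {n} {f : A → A} (xs : Vec A n) → (∀ k → f (lookup xs k) ≡ lookup xs k) → Vec.map f xs ≡ xs
  map-fixes []       _     = refl
  map-fixes (x ∷ xs) fixes = cong₂ _∷_ (fixes zero) (map-fixes xs (fixes ∘ suc))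

  module _ {n} {v : Fin (suc (suc n))} {τ : Vec (Fin (suc (suc n))) (suc n)} (perm : IsPermutation (v ∷ τ)) where

    head≢tail : ∀ k → v ≢ lookup τ k
    head≢tail k eq with injective perm {zero} {suc k} eq
    ... | ()

    prepend-unprepend : uncurry prepend (unprepend (v ∷ τ)) ≡ v ∷ τ
    prepend-unprepend = cong (v ∷_) (begin
      Vec.map (punchIn v) (Vec.map (unpunch v) τ) ≡⟨ Vec.map-∘ (punchIn v) (unpunch v) τ ⟨
      Vec.map (punchIn v ∘ unpunch v) τ          ≡⟨ map-fixes τ (λ k → punchIn-unpunch v _ (head≢tail k)) ⟩
      τ                                          ∎)

    unprepend-perm : IsPermutation (proj₂ (unprepend (v ∷ τ)))
    unprepend-perm = isPermutation λ {k} {k′} eq → suc-injective (injective perm (begin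
      lookup τ k                            ≡⟨ punchIn-unpunch v _ (head≢tail k) ⟨
      punchIn v (unpunch v (lookup τ k))    ≡⟨ cong (punchIn v) (trans (sym (lookup-map k (unpunch v) τ))
                                                                      (trans eq (lookup-map k′ (unpunch v) τ))) ⟩
      punchIn v (unpunch v (lookup τ k′))   ≡⟨ punchIn-unpunch v _ (head≢tail k′) ⟩
      lookup τ k′                           ∎))

  ∑-Sn-prepend : ∀ {n} (F : Vec (Fin (suc (suc n))) (suc (suc n)) → ℕ) →
    ∑ F (Sn (suc (suc n))) ≡ ∑ (λ v → ∑ (F ∘ prepend v) (Sn (suc n))) (allFin (suc (suc n)))
  ∑-Sn-prepend {n} F = begin
    ∑ F (Sn (suc (suc n)))
      ≡⟨ ∑-bijection (≡-dec _≟_) F (uncurry prepend) unprepend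
           (Unique.cartesianProduct⁺ (Unique.allFin⁺ _) (Sn-unique _)) (Sn-unique _)
           (λ {(v , σ)} vσ∈ →
              ∈-Sn⁺ (prepend-perm v (∈-Sn⁻ (proj₂ (∈-cartesianProduct⁻ (allFin _) (Sn _) vσ∈)))))
           (λ { {v ∷ τ} π∈ → ∈-cartesianProduct⁺ (∈-allFin v) (∈-Sn⁺ (unprepend-perm (∈-Sn⁻ π∈))) })
           (λ {(v , σ)} _ → unprepend-prepend v σ)
           (λ { {v ∷ τ} π∈ → prepend-unprepend (∈-Sn⁻ π∈) }) ⟨
    ∑ (F ∘ uncurry prepend) (cartesianProduct (allFin (suc (suc n))) (Sn (suc n)))
      ≡⟨ ∑-cartesianProductWith (F ∘ uncurry prepend) _,_ (allFin _) (Sn _) ⟩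
    ∑ (λ v → ∑ (F ∘ prepend v) (Sn (suc n))) (allFin (suc (suc n))) ∎

  length-Sn : ∀ N → length (Sn N) ≡ N !
  length-Sn zero          = refl
  length-Sn (suc zero)    = refl
  length-Sn (suc (suc n)) = begin
    length (Sn (suc (suc n)))
      ≡⟨ ∑-1≡length (Sn (suc (suc n))) ⟨
    ∑ (λ _ → 1) (Sn (suc (suc n)))
      ≡⟨ ∑-Sn-prepend {n} (λ _ → 1) ⟩
    ∑ (λ _ → ∑ (λ _ → 1) (Sn (suc n))) (allFin (suc (suc n)))
      ≡⟨ ∑-cong (allFin (suc (suc n))) (λ _ →
           trans (∑-1≡length (Sn (suc n))) (trans (length-Sn (suc n)) (sym (*-identityʳ _)))) ⟩
    ∑ (λ _ → suc n ! * 1) (allFin (suc (suc n)))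
      ≡⟨ ∑-*ˡ (suc n !) (λ _ → 1) (allFin (suc (suc n))) ⟩
    suc n ! * ∑ (λ _ → 1) (allFin (suc (suc n)))
      ≡⟨ cong (suc n ! *_) (∑-allFin-1 (suc (suc n))) ⟩
    suc n ! * suc (suc n)
      ≡⟨ *-comm (suc n !) (suc (suc n)) ⟩
    suc (suc n) ! ∎

  count-starting-with-largest : ∀ n → ∑ (λ σ → 𝟙 ⌊ lookup σ zero ≟ largest ⌋) (Sn (suc n)) ≡ n !
  count-starting-with-largest zero    = refl
  count-starting-with-largest (suc n) = begin
    ∑ (λ σ → 𝟙 ⌊ lookup σ zero ≟ largest ⌋) (Sn (suc (suc n)))
      ≡⟨ ∑-Sn-prepend {n} (λ σ → 𝟙 ⌊ lookup σ zero ≟ largest ⌋) ⟩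
    ∑ (λ v → ∑ (λ _ → 𝟙 ⌊ v ≟ largest ⌋) (Sn (suc n))) (allFin (suc (suc n)))
      ≡⟨ ∑-comm (λ v (_ : Vec (Fin (suc n)) (suc n)) → 𝟙 ⌊ v ≟ largest ⌋) (allFin (suc (suc n))) (Sn (suc n)) ⟩
    ∑ (λ _ → ∑ (λ v → 𝟙 ⌊ v ≟ largest ⌋) (allFin (suc (suc n)))) (Sn (suc n))
      ≡⟨ ∑-cong (Sn (suc n)) (λ _ → ∑-allFin-≟ (largest {suc n})) ⟩
    ∑ (λ _ → 1) (Sn (suc n))
      ≡⟨ ∑-1≡length (Sn (suc n)) ⟩
    length (Sn (suc n))
      ≡⟨ length-Sn (suc n) ⟩
    suc n ! ∎

  toℕ-punchIn-≥ : ∀ {n} (v : Fin (suc n)) (x : Fin n) → toℕ v ≤ toℕ x → toℕ (punchIn v x) ≡ suc (toℕ x)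
  toℕ-punchIn-≥ zero    x       _         = refl
  toℕ-punchIn-≥ (suc v) (suc x) (s≤s v≤x) = cong suc (toℕ-punchIn-≥ v x v≤x)

  punchIn-mono-< : ∀ {n} (v : Fin (suc n)) {x y : Fin n} → toℕ x < toℕ y → toℕ (punchIn v x) < toℕ (punchIn v y)
  punchIn-mono-< v {x} {y} x<y = ≤∧≢⇒< (punchIn-mono-≤ v x y (<⇒≤ x<y))
    (λ eq → <-irrefl (cong toℕ (punchIn-injective v x y (toℕ-injective eq))) x<y)

  punchIn-cancel-< : ∀ {n} (v : Fin (suc n)) {x y : Fin n} → toℕ (punchIn v x) < toℕ (punchIn v y) → toℕ x < toℕ y
  punchIn-cancel-< v {x} {y} vx<vy = ≰⇒> λ y≤x → <⇒≱ vx<vy (punchIn-mono-≤ v y x y≤x)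

  module _ {n} {v : Fin (suc (suc n))} (v≢ : v ≢ largest) where

    punchIn-largest : punchIn v largest ≡ largest
    punchIn-largest = toℕ-injective (begin
      toℕ (punchIn v largest)
        ≡⟨ toℕ-punchIn-≥ v largest (subst (toℕ v ≤_) (sym toℕ-largest) (≤-pred (≢largest⇒< v≢))) ⟩
      suc (toℕ (largest {n}))  ≡⟨ cong suc toℕ-largest ⟩
      suc n                   ≡⟨ toℕ-largest ⟨
      toℕ (largest {suc n})    ∎)

    punchIn≡largest : ∀ {x} → punchIn v x ≡ largest → x ≡ largest
    punchIn≡largest eq = punchIn-injective v _ _ (trans eq (sym punchIn-largest))

  secondLargest : ∀ {n} → Fin (suc (suc n))
  secondLargest = inject₁ largest

  toℕ-secondLargest : ∀ {n} → toℕ (secondLargest {n}) ≡ n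
  toℕ-secondLargest = trans (toℕ-inject₁ largest) toℕ-largest

  secondLargest≢largest : ∀ {n} → secondLargest {n} ≢ largest
  secondLargest≢largest eq = 1+n≢n (sym (trans (sym toℕ-secondLargest) (trans (cong toℕ eq) toℕ-largest)))

  module _ {n} (v : Fin (suc (suc n))) {σ : Vec (Fin (suc n)) (suc n)} (perm : IsPermutation σ) where

    private
      π : Vec (Fin (suc (suc n))) (suc (suc n))
      π = prepend v σ
      π-perm : IsPermutation π
      π-perm = prepend-perm v perm

    witness-prepend⁻ : Witness₅ π → v ≢ largest × (Witness₅ σ ⊎ (lookup σ zero ≡ largest × v ≡ secondLargest))
    witness-prepend⁻ (witness q π-max tail<) = v≢ , from-q q π-max tail<
      where
      v≢ : v ≢ largest
      v≢ v≡ with injective π-perm {zero} {suc q} (trans v≡ (sym π-max))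
      ... | ()
      from-q : ∀ q → lookup π (suc q) ≡ largest →
               (∀ k → suc (toℕ q) < toℕ k → toℕ (lookup π k) < toℕ (lookup π (inject₁ q))) →
               Witness₅ σ ⊎ (lookup σ zero ≡ largest × v ≡ secondLargest)
      from-q (suc q′) π-max tail< = inj₁ (witness q′
        (punchIn≡largest v≢ (trans (sym (lookup-prepend v σ (suc q′))) π-max))
        λ k q′<k → punchIn-cancel-< v (subst₂ (λ a b → toℕ a < toℕ b)
          (lookup-prepend v σ k) (lookup-prepend v σ (inject₁ q′)) (tail< (suc k) (s<s q′<k))))
      from-q zero π-max tail< = inj₂ (punchIn≡largest v≢ (trans (sym (lookup-prepend v σ zero)) π-max) ,
                                      at (preimage π secondLargest) (lookup-preimage π-perm secondLargest))
        where
        at : ∀ x → lookup π x ≡ secondLargest → v ≡ secondLargest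
        at zero             πx≡ = πx≡
        at (suc zero)       πx≡ = ⊥-elim (secondLargest≢largest (trans (sym πx≡) π-max))
        at (suc (suc x))    πx≡ = ⊥-elim (<⇒≱ (subst (_< toℕ v) (trans (cong toℕ πx≡) toℕ-secondLargest)
                                                    (tail< (suc (suc x)) (s<s z<s)))
                                             (≤-pred (≢largest⇒< v≢)))

    witness-prepend⁺₁ : v ≢ largest → Witness₅ σ → Witness₅ π
    witness-prepend⁺₁ v≢ (witness q σ-max tail<) =
      witness (suc q)
        (trans (lookup-prepend v σ (suc q)) (trans (cong (punchIn v) σ-max) (punchIn-largest v≢))) tail
      where
      tail : ∀ k → suc (suc (toℕ q)) < toℕ k → toℕ (lookup π k) < toℕ (lookup π (suc (inject₁ q)))
      tail (suc k) (s<s q<k) = subst₂ (λ a b → toℕ a < toℕ b) (sym (lookup-prepend v σ k))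
        (sym (lookup-prepend v σ (inject₁ q))) (punchIn-mono-< v (tail< k q<k))

    witness-prepend⁺₂ : lookup σ zero ≡ largest → v ≡ secondLargest → Witness₅ π
    witness-prepend⁺₂ σ0≡ v≡ = witness zero π1≡ tail
      where
      π1≡ : lookup π (suc zero) ≡ largest
      π1≡ = trans (lookup-prepend v σ zero)
              (trans (cong (punchIn v) σ0≡) (punchIn-largest (secondLargest≢largest ∘ trans (sym v≡))))
      v≡n : toℕ v ≡ n
      v≡n = trans (cong toℕ v≡) toℕ-secondLargest
      tail : ∀ k → 1 < toℕ k → toℕ (lookup π k) < toℕ v
      tail k 1<k = subst (toℕ (lookup π k) <_) (sym v≡n)
        (≤∧≢⇒< (≤-pred (≢largest⇒< πk≢largest)) (λ πk≡n → πk≢v (toℕ-injective (trans πk≡n (sym v≡n)))))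
        where
        πk≢largest : lookup π k ≢ largest
        πk≢largest πk≡ = <-irrefl (cong toℕ (injective π-perm (trans π1≡ (sym πk≡)))) 1<k
        πk≢v : lookup π k ≢ v
        πk≢v πk≡ = <-irrefl (cong toℕ (injective π-perm {zero} {k} (sym πk≡))) (<-trans z<s 1<k)

  module _ {n} {σ : Vec (Fin (suc n)) (suc n)} (perm : IsPermutation σ) where

    private
      N : ℕ
      N = suc (suc n)

    largest-first⇒¬witness : lookup σ zero ≡ largest → ¬ Witness₅ σ
    largest-first⇒¬witness σ0≡ (witness q σ-max _) with injective perm {zero} {suc q} (trans σ0≡ (sym σ-max))
    ... | ()

    avoids₅-prepend-largest-first : lookup σ zero ≡ largest →
      ∀ v → avoids₅ (prepend v σ) ≡ not ⌊ v ≟ secondLargest ⌋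
    avoids₅-prepend-largest-first σ0≡ v with v ≟ secondLargest
    ... | yes v≡ = avoids₅-witness (prepend-perm v perm) (witness-prepend⁺₂ v perm σ0≡ v≡)
    ... | no  v≢ = avoids₅-¬witness (prepend-perm v perm) λ w →
                     [ largest-first⇒¬witness σ0≡ , v≢ ∘ proj₂ ] (proj₂ (witness-prepend⁻ v perm w))

    avoids₅-prepend-witness : Witness₅ σ → ∀ v → avoids₅ (prepend v σ) ≡ ⌊ v ≟ largest ⌋
    avoids₅-prepend-witness w v with v ≟ largest
    ... | yes v≡ = avoids₅-¬witness (prepend-perm v perm) λ w′ → proj₁ (witness-prepend⁻ v perm w′) v≡
    ... | no  v≢ = avoids₅-witness (prepend-perm v perm) (witness-prepend⁺₁ v perm v≢ w)

    avoids₅-prepend-avoider : lookup σ zero ≢ largest → ¬ Witness₅ σ → ∀ v → avoids₅ (prepend v σ) ≡ true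
    avoids₅-prepend-avoider σ0≢ ¬w v = avoids₅-¬witness (prepend-perm v perm) λ w →
      [ ¬w , σ0≢ ∘ proj₁ ] (proj₂ (witness-prepend⁻ v perm w))

    avoiders-prepend : ∑ (λ v → 𝟙 (avoids₅ (prepend v σ))) (allFin N) + 𝟙 ⌊ lookup σ zero ≟ largest ⌋
                       ≡ 1 + suc n * 𝟙 (avoids₅ σ)
    avoiders-prepend with lookup σ zero ≟ largest | witness? perm
    ... | yes σ0≡ | yes w  = ⊥-elim (largest-first⇒¬witness σ0≡ w)
    ... | yes σ0≡ | no  ¬w = begin
      ∑ (λ v → 𝟙 (avoids₅ (prepend v σ))) (allFin N) + 1
        ≡⟨ cong (_+ 1) (∑-cong (allFin N) (λ {v} _ → cong 𝟙 (avoids₅-prepend-largest-first σ0≡ v))) ⟩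
      ∑ (λ v → 𝟙 (not ⌊ v ≟ secondLargest ⌋)) (allFin N) + 1
        ≡⟨ ∑-allFin-≢ (secondLargest {n}) ⟩
      suc (suc n)
        ≡⟨ trans (cong (λ b → 1 + suc n * 𝟙 b) (avoids₅-¬witness perm ¬w)) (cong suc (*-identityʳ (suc n))) ⟨
      1 + suc n * 𝟙 (avoids₅ σ) ∎
    ... | no  σ0≢ | yes w  = begin
      ∑ (λ v → 𝟙 (avoids₅ (prepend v σ))) (allFin N) + 0
        ≡⟨ cong (_+ 0) (∑-cong (allFin N) (λ {v} _ → cong 𝟙 (avoids₅-prepend-witness w v))) ⟩
      ∑ (λ v → 𝟙 ⌊ v ≟ largest ⌋) (allFin N) + 0
        ≡⟨ cong (_+ 0) (∑-allFin-≟ (largest {suc n})) ⟩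
      1
        ≡⟨ trans (cong (λ b → 1 + suc n * 𝟙 b) (avoids₅-witness perm w)) (cong suc (*-zeroʳ n)) ⟨
      1 + suc n * 𝟙 (avoids₅ σ) ∎
    ... | no  σ0≢ | no  ¬w = begin
      ∑ (λ v → 𝟙 (avoids₅ (prepend v σ))) (allFin N) + 0
        ≡⟨ cong (_+ 0) (∑-cong (allFin N) (λ {v} _ → cong 𝟙 (avoids₅-prepend-avoider σ0≢ ¬w v))) ⟩
      ∑ (λ _ → 1) (allFin N) + 0
        ≡⟨ cong (_+ 0) (∑-allFin-1 N) ⟩
      suc (suc n) + 0
        ≡⟨ +-identityʳ _ ⟩
      suc (suc n)
        ≡⟨ trans (cong (λ b → 1 + suc n * 𝟙 b) (avoids₅-¬witness perm ¬w)) (cong suc (*-identityʳ (suc n))) ⟨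
      1 + suc n * 𝟙 (avoids₅ σ) ∎

  avoiders-recurrence : ∀ n → s R₅ (suc (suc n)) 0 + n ! ≡ suc n ! + suc n * s R₅ (suc n) 0
  avoiders-recurrence n = begin
    s R₅ (suc (suc n)) 0 + n !
      ≡⟨ cong₂ _+_ (s≡∑ R₅ (suc (suc n)) 0) (sym (count-starting-with-largest n)) ⟩
    ∑ (𝟙 ∘ avoids₅) (Sn (suc (suc n))) + ∑ starts-with-largest (Sn (suc n))
      ≡⟨ cong (_+ ∑ starts-with-largest (Sn (suc n))) (trans (∑-Sn-prepend {n} (𝟙 ∘ avoids₅))
           (∑-comm (λ v σ → 𝟙 (avoids₅ (prepend v σ))) (allFin (suc (suc n))) (Sn (suc n)))) ⟩
    ∑ extensions (Sn (suc n)) + ∑ starts-with-largest (Sn (suc n))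
      ≡⟨ ∑-+ extensions starts-with-largest (Sn (suc n)) ⟨
    ∑ (λ σ → extensions σ + starts-with-largest σ) (Sn (suc n))
      ≡⟨ ∑-cong (Sn (suc n)) (λ σ∈ → avoiders-prepend (∈-Sn⁻ σ∈)) ⟩
    ∑ (λ σ → 1 + suc n * 𝟙 (avoids₅ σ)) (Sn (suc n))
      ≡⟨ ∑-+ (λ _ → 1) (λ σ → suc n * 𝟙 (avoids₅ σ)) (Sn (suc n)) ⟩
    ∑ (λ _ → 1) (Sn (suc n)) + ∑ (λ σ → suc n * 𝟙 (avoids₅ σ)) (Sn (suc n))
      ≡⟨ cong₂ _+_ (trans (∑-1≡length (Sn (suc n))) (length-Sn (suc n)))
                   (trans (∑-*ˡ (suc n) (𝟙 ∘ avoids₅) (Sn (suc n)))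
                          (cong (suc n *_) (sym (s≡∑ R₅ (suc n) 0)))) ⟩
    suc n ! + suc n * s R₅ (suc n) 0 ∎
    where
    starts-with-largest : Vec (Fin (suc n)) (suc n) → ℕ
    starts-with-largest σ = 𝟙 ⌊ lookup σ zero ≟ largest ⌋
    extensions : Vec (Fin (suc n)) (suc n) → ℕ
    extensions σ = ∑ (λ v → 𝟙 (avoids₅ (prepend v σ))) (allFin (suc (suc n)))

open import Defs
open import Data.Integer using (+_)
import Data.Integer as ℤ
import Data.Integer.Properties as ℤ
open import Data.List.Membership.Propositional using (_∈_)
import Data.List.Relation.Unary.All as All
open import Data.Nat using (ℕ; zero; suc; _!)
import Data.Nat as ℕ
import Data.Nat.Properties as ℕ
open import Data.Nat.Coprimality using (1-coprimeTo)
import Data.Nat.Coprimality as Coprime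
open import Data.Product using (_×_; _,_)
open import Data.Rational using (ℚ; mkℚ; _+_; _*_; _-_; _/_; 1ℚ)
open import Data.Rational.Properties using (↥p/↧p≡p; *-inverseʳ)
open import Data.Rational.Solver using (module +-*-Solver)
open import Relation.Binary.PropositionalEquality using (_≡_; refl; sym; trans; cong; cong₂; module ≡-Reasoning)

open MeshPatterns using (Equidistributed; s≡; R₅; patterns∼R₅; avoiders-recurrence)
open ≡-Reasoning
open +-*-Solver

-- Harmonic numbers

-- n / 1 in normal form, on which _+_ and _*_ of ℚ compute.
private
  fromℕ : ℕ → ℚ
  fromℕ n = mkℚ (+ n) 0 (Coprime.sym (1-coprimeTo n))

  ℕtoℚ≡fromℕ : ∀ n → ℕtoℚ n ≡ fromℕ n
  ℕtoℚ≡fromℕ n = ↥p/↧p≡p (fromℕ n)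

ℕtoℚ-+ : ∀ a b → ℕtoℚ (a ℕ.+ b) ≡ ℕtoℚ a + ℕtoℚ b
ℕtoℚ-+ a b = begin
  ℕtoℚ (a ℕ.+ b)
    ≡⟨ cong (_/ 1) (trans (ℤ.pos-+ a b) (sym (cong₂ ℤ._+_ (ℤ.*-identityʳ (+ a)) (ℤ.*-identityʳ (+ b))))) ⟩
  ((+ a) ℤ.* (+ 1) ℤ.+ (+ b) ℤ.* (+ 1)) / 1   ≡⟨⟩
  fromℕ a + fromℕ b                            ≡⟨ cong₂ _+_ (ℕtoℚ≡fromℕ a) (ℕtoℚ≡fromℕ b) ⟨
  ℕtoℚ a + ℕtoℚ b                              ∎

ℕtoℚ-* : ∀ a b → ℕtoℚ (a ℕ.* b) ≡ ℕtoℚ a * ℕtoℚ b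
ℕtoℚ-* a b = begin
  ℕtoℚ (a ℕ.* b)           ≡⟨ cong (_/ 1) (ℤ.pos-* a b) ⟩
  ((+ a) ℤ.* (+ b)) / 1    ≡⟨⟩
  fromℕ a * fromℕ b        ≡⟨ cong₂ _*_ (ℕtoℚ≡fromℕ a) (ℕtoℚ≡fromℕ b) ⟨
  ℕtoℚ a * ℕtoℚ b          ∎

ℕtoℚ-suc*reciprocal : ∀ m → ℕtoℚ (suc m) * ((+ 1) / suc m) ≡ 1ℚ
ℕtoℚ-suc*reciprocal m = begin
  ℕtoℚ (suc m) * ((+ 1) / suc m)
    ≡⟨ cong₂ _*_ (ℕtoℚ≡fromℕ (suc m)) (↥p/↧p≡p (mkℚ (+ 1) m (1-coprimeTo (suc m)))) ⟩
  fromℕ (suc m) * mkℚ (+ 1) m (1-coprimeTo (suc m))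
    ≡⟨ *-inverseʳ (fromℕ (suc m)) ⟩
  1ℚ ∎

harmonic-closed-form : (a : ℕ → ℕ) → a 1 ≡ 1 →
  (∀ m → a (suc (suc m)) ℕ.+ m ! ≡ suc m ! ℕ.+ suc m ℕ.* a (suc m)) →
  ∀ m → ℕtoℚ (a (suc m)) ≡ ℕtoℚ (m !) * (ℕtoℚ (suc m) - H m)
harmonic-closed-form a a₁ step zero    = cong ℕtoℚ a₁
harmonic-closed-form a a₁ step (suc m) = begin
  A₂                                       ≡⟨ solve 2 (λ A₂ x → A₂ := (A₂ :+ x) :- x) refl A₂ x ⟩
  (A₂ + x) - x                             ≡⟨ cong (_- x) step-ℚ ⟩
  (M * x + M * A₁) - x
    ≡⟨ cong (λ y → (M * x + M * y) - x) (harmonic-closed-form a a₁ step m) ⟩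
  (M * x + M * (x * (M - h))) - x
    -- split off x · (M · r − 1), which vanishes since M · r = 1
    ≡⟨ solve 4 (λ M x h r → (M :* x :+ M :* (x :* (M :- h))) :- x
                          := (M :* x) :* ((M :+ con 1ℚ) :- (h :+ r)) :+ x :* (M :* r :- con 1ℚ)) refl M x h r ⟩
  (M * x) * ((M + 1ℚ) - (h + r)) + x * (M * r - 1ℚ)
    ≡⟨ cong (λ y → (M * x) * ((M + 1ℚ) - (h + r)) + x * (y - 1ℚ)) (ℕtoℚ-suc*reciprocal m) ⟩
  (M * x) * ((M + 1ℚ) - (h + r)) + x * (1ℚ - 1ℚ)
    ≡⟨ solve 3 (λ y x o → y :+ x :* (o :- o) := y) refl ((M * x) * ((M + 1ℚ) - (h + r))) x 1ℚ ⟩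
  (M * x) * ((M + 1ℚ) - (h + r))
    ≡⟨ cong₂ (λ u v → u * (v - (h + r))) (sym (ℕtoℚ-* (suc m) (m !))) (sym (ℕtoℚ-+ (suc m) 1)) ⟩
  ℕtoℚ (suc m !) * (ℕtoℚ (suc m ℕ.+ 1) - H (suc m))
    ≡⟨ cong (λ n → ℕtoℚ (suc m !) * (ℕtoℚ n - H (suc m))) (ℕ.+-comm (suc m) 1) ⟩
  ℕtoℚ (suc m !) * (ℕtoℚ (suc (suc m)) - H (suc m)) ∎
  where
  A₁ A₂ x M h r : ℚ
  A₁ = ℕtoℚ (a (suc m))
  A₂ = ℕtoℚ (a (suc (suc m)))
  x = ℕtoℚ (m !)
  M = ℕtoℚ (suc m)
  h = H m
  r = (+ 1) / suc m
  step-ℚ : A₂ + x ≡ M * x + M * A₁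
  step-ℚ = begin
    A₂ + x                                   ≡⟨ ℕtoℚ-+ (a (suc (suc m))) (m !) ⟨
    ℕtoℚ (a (suc (suc m)) ℕ.+ m !)           ≡⟨ cong ℕtoℚ (step m) ⟩
    ℕtoℚ (suc m ! ℕ.+ suc m ℕ.* a (suc m))
      ≡⟨ trans (ℕtoℚ-+ (suc m !) (suc m ℕ.* a (suc m)))
               (cong₂ _+_ (ℕtoℚ-* (suc m) (m !)) (ℕtoℚ-* (suc m) (a (suc m)))) ⟩
    M * x + M * A₁                           ∎

theorem3p11 :
  ((R₁ R₂ : Mesh) → R₁ ∈ patterns → R₂ ∈ patterns →
    (n k : ℕ) → s R₁ n k ≡ s R₂ n k)
  × ((R : Mesh) → R ∈ patterns → (m : ℕ) →
    ℕtoℚ (s R (suc m) 0) ≡ ℕtoℚ (m !) * (ℕtoℚ (suc m) - H m))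
theorem3p11 = equidistributed , avoiders
  where
  to-R₅ : ∀ {R} → R ∈ patterns → Equidistributed R R₅
  to-R₅ = All.lookup patterns∼R₅
  equidistributed : (R₁ R₂ : Mesh) → R₁ ∈ patterns → R₂ ∈ patterns → (n k : ℕ) → s R₁ n k ≡ s R₂ n k
  equidistributed R₁ R₂ R₁∈ R₂∈ n k = trans (s≡ (to-R₅ R₁∈) n k) (sym (s≡ (to-R₅ R₂∈) n k))
  avoiders : (R : Mesh) → R ∈ patterns → (m : ℕ) →
             ℕtoℚ (s R (suc m) 0) ≡ ℕtoℚ (m !) * (ℕtoℚ (suc m) - H m)
  avoiders R R∈ m = trans (cong ℕtoℚ (s≡ (to-R₅ R∈) (suc m) 0))
    (harmonic-closed-form (λ n → s R₅ n 0) refl avoiders-recurrence m)
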